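{- Let $d\geq 3$ be an integer and let $P_d(t)=\sum_{n\geq 1}a_{d,n}t^n$, where $a_{d,n}$ is the number of directed plateau polyhypercubes of dimension $d$ (of any width $k\geq 1$) with lateral area $n$. Then, as formal power series, $$P_d(t)=\frac{t^{d-1}(1-t)^{d-1}}{(1-t)^{2(d-1)}-t^{d-1}}.$$
   Context: Work in $\mathbb{Z}^d$ with orthonormal coordinate system $(0,\vec{i_1},\dots,\vec{i_d})$. A cell is a unit hypercube with integer vertices. A polyhypercube of dimension $d$ is a finite union of cells, connected through their $(d-1)$-dimensional faces, defined up to translation. An elementary step is a positive move of one unit along one of the axes $\vec{i_j}$. A polyhypercube is directed if there is a root cell from which every cell can be reached by a path of cells made only of elementary steps. A stratum is the set of cells with a given $\vec{i_1}$-coordinate. A plateau is a stratum that is a hyperrectangle (box) of cells; a directed plateau polyhypercube is a directed polyhypercube all of whose strata are plateaus. The lateral area of a polyhypercube is the sum, over $2\leq l\leq d$, of the areas (numbers of unit squares) of the polyominoes obtained by projecting it onto the planes $(\vec{i_1},\vec{i_l})$. -}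

module Defs where

open import Data.Nat as ℕ using (ℕ; zero; suc; _∸_)
open import Data.Integer as ℤ using (ℤ; +_; _≤_)
open import Data.Fin using (Fin)
open import Data.Vec as V using (Vec; _∷_; head; tail; lookup; zipWith; _[_]%=_)
open import Data.Vec.Relation.Binary.Pointwise.Inductive using (Pointwise)
open import Data.List as L using (List; length; deduplicate; allFin)
open import Data.Nat.ListAction using (sum)
open import Data.List.Membership.Propositional using (_∈_; _∉_)
open import Data.List.Relation.Unary.All using (All)
open import Data.List.Relation.Unary.AllPairs using (AllPairs)
open import Data.Product using (Σ; ∃; _×_; _,_)
open import Data.Product.Properties using (≡-dec)
open import Relation.Binary.PropositionalEquality using (_≡_)
open import Relation.Nullary using (¬_)
open import Function.Bundles using (_⇔_)

-- A cell is identified with its minimal (integer) vertex.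
Cell : ℕ → Set
Cell d = Vec ℤ d

-- A finite set of cells, represented by a list (read as a set:
-- only membership matters).
CellSet : ℕ → Set
CellSet d = List (Cell d)

step : ∀ {d} → Cell d → Fin d → Cell d
step c j = c [ j ]%= ℤ.suc

backstep : ∀ {d} → Cell d → Fin d → Cell d
backstep c j = c [ j ]%= ℤ.pred

data Connected {d} (A : CellSet d) : Cell d → Cell d → Set where
  here  : ∀ {a} → a ∈ A → Connected A a a
  fwd   : ∀ {a b} (j : Fin d) → Connected A a b → step b j ∈ A →
          Connected A a (step b j)
  bwd   : ∀ {a b} (j : Fin d) → Connected A a b → backstep b j ∈ A →
          Connected A a (backstep b j)

data DirPath {d} (A : CellSet d) : Cell d → Cell d → Set where
  here : ∀ {a} → a ∈ A → DirPath A a a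
  fwd  : ∀ {a b} (j : Fin d) → DirPath A a b → step b j ∈ A →
         DirPath A a (step b j)

IsPolyhypercube : ∀ {d} → CellSet d → Set
IsPolyhypercube {d} A =
  (∃ λ (a : Cell d) → a ∈ A) × (∀ {a b} → a ∈ A → b ∈ A → Connected A a b)

IsDirected : ∀ {d} → CellSet d → Set
IsDirected {d} A = Σ (Cell d) λ r → r ∈ A × (∀ {c} → c ∈ A → DirPath A r c)

-- Dimension d = suc m: coordinate i₁ is the head, i₂..i_d the tail.
-- Every (nonempty) stratum is a hyperrectangle of cells.
IsPlateauPoly : ∀ {m} → CellSet (suc m) → Set
IsPlateauPoly {m} A =
  ∀ {c} → c ∈ A →
    Σ (Vec ℤ m) λ lo → Σ (Vec ℤ m) λ hi →
      ∀ (e : Vec ℤ m) →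
        ((head c ∷ e) ∈ A) ⇔ (Pointwise _≤_ lo e × Pointwise _≤_ e hi)

IsDirectedPlateau : ∀ {m} → CellSet (suc m) → Set
IsDirectedPlateau A = IsPolyhypercube A × IsDirected A × IsPlateauPoly A

-- Area of the projection onto the plane (i₁, i_l), l = suc j :
-- the number of distinct pairs (c₁ , c_l).
projArea : ∀ {m} → CellSet (suc m) → Fin m → ℕ
projArea A j =
  length (deduplicate (≡-dec ℤ._≟_ ℤ._≟_)
           (L.map (λ c → head c , lookup (tail c) j) A))

lateralArea : ∀ {m} → CellSet (suc m) → ℕ
lateralArea {m} A = sum (L.map (projArea A) (allFin m))

Translate : ∀ {d} → CellSet d → CellSet d → Set
Translate {d} A B =
  Σ (Cell d) λ v → ∀ (c : Cell d) → (c ∈ A) ⇔ (zipWith ℤ._+_ c v ∈ B)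

CountDPP : ℕ → ℕ → ℕ → Set
CountDPP m n k =
  Σ (List (CellSet (suc m))) λ Ls →
    length Ls ≡ k ×
    All (λ A → IsDirectedPlateau A × lateralArea A ≡ n) Ls ×
    AllPairs (λ A B → ¬ Translate A B) Ls ×
    (∀ (A : CellSet (suc m)) → IsDirectedPlateau A → lateralArea A ≡ n →
       Σ (CellSet (suc m)) λ B → B ∈ Ls × Translate A B)

FPS : Set
FPS = ℕ → ℤ

sumTo : ℕ → (ℕ → ℤ) → ℤ
sumTo zero    f = f 0
sumTo (suc n) f = sumTo n f ℤ.+ f (suc n)

_⊛_ : FPS → FPS → FPS
(f ⊛ g) n = sumTo n (λ i → f i ℤ.* g (n ∸ i))

_⊝_ : FPS → FPS → FPS
(f ⊝ g) n = f n ℤ.- g n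

oneS : FPS
oneS zero    = + 1
oneS (suc _) = + 0

tS : FPS
tS 1 = + 1
tS _ = + 0

_^S_ : FPS → ℕ → FPS
f ^S zero  = oneS
f ^S suc k = f ⊛ (f ^S k)

-- Translate a directed plateau polyhypercube so that its root is the origin.
-- Its strata are then boxes B₀, B₁, …, B_H, and directedness says exactly
-- that the lowest corner of B_(h+1) lies in B_h: that corner can only be
-- entered from below. The projection onto the plane (i₁, i_l) consists of
-- one segment per stratum, as long as the side of the box along i_l, so the
-- lateral area is the sum of the side sums of the boxes. Choosing the first
-- box, and then the corner of the next stratum inside it, gives
-- a_n = L_n + Σ_i M_i a_(n-i), where L counts boxes by side sum and M counts
-- boxes with a marked cell. As generating functions L = (t/(1-t))^(d-1) and
-- M = (t/(1-t)²)^(d-1), and solving A = L + M A gives the formula.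

module Submission where

open import Defs
open import Data.Nat as ℕ using (ℕ; zero; suc; _∸_; _≤_; _<_; z≤n; s≤s)
import Data.Nat.Properties as ℕP
open import Algebra.Properties.CommutativeSemigroup ℕP.+-commutativeSemigroup using () renaming (interchange to ℕ-+-interchange)
open import Data.Nat.ListAction using (sum)
open import Data.Nat.ListAction.Properties using (sum-++)
open import Data.Integer as ℤ using (ℤ; +_; +≤+)
import Data.Integer.Properties as ℤP
open import Data.Integer.Tactic.RingSolver using (solve-∀)
open import Data.Fin using (Fin; zero; suc)
open import Data.Vec as V using (Vec; []; _∷_; lookup)
open import Data.Vec.Relation.Binary.Pointwise.Inductive as PW using (Pointwise; []; _∷_)
open import Data.List as L using (List; []; _∷_; _++_; [_]; length; concatMap; map; upTo; applyUpTo)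
import Data.List.Properties as LP
open import Data.List.Extrema.Nat using (argmax; argmax-all; f[xs]≤f[argmax])
open import Data.List.Membership.Propositional using (_∈_; find; lose)
open import Data.List.Membership.Propositional.Properties
open import Data.List.Membership.Propositional.Properties.WithK using (unique∧set⇒bag)
open import Data.List.Relation.Unary.Any using (here)
open import Data.List.Relation.Unary.All as All using (All; []; _∷_)
import Data.List.Relation.Unary.All.Properties as AllP
open import Data.List.Relation.Unary.AllPairs using (AllPairs; []; _∷_)
open import Data.List.Relation.Unary.Unique.Propositional using (Unique)
import Data.List.Relation.Unary.Unique.Propositional.Properties as UniqueP
import Data.List.Relation.Unary.Unique.DecPropositional.Properties as UniqueDecP
open import Data.List.Relation.Binary.BagAndSetEquality using (∼bag⇒↭)
open import Data.List.Relation.Binary.Permutation.Propositional.Properties using (↭-length)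
open import Data.Product using (Σ; _×_; _,_; proj₁; proj₂)
open import Data.Sum using (_⊎_; inj₁; inj₂)
open import Data.Unit using (⊤; tt)
open import Data.Empty using (⊥-elim)
open import Relation.Nullary using (¬_; yes; no)
open import Relation.Binary.Definitions using (DecidableEquality)
open import Relation.Binary.PropositionalEquality hiding ([_])
open import Function using (_∘_; id; _∋_)
open import Function.Bundles using (_⇔_; mk⇔; Equivalence)

-- Formal power series

module PowerSeries where

  open import Data.Integer using (_+_; _*_; -_; _-_)

  _⊕_ : FPS → FPS → FPS
  (f ⊕ g) n = f n + g n

  _·_ : ℤ → FPS → FPS
  (c · f) n = c * f n

  shift : FPS → FPS
  shift f = f ∘ suc

  sumTo-cong : ∀ n {f g : ℕ → ℤ} → (∀ i → i ≤ n → f i ≡ g i) → sumTo n f ≡ sumTo n g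
  sumTo-cong zero    f≡g = f≡g 0 z≤n
  sumTo-cong (suc n) f≡g =
    cong₂ _+_ (sumTo-cong n (λ i i≤n → f≡g i (ℕP.m≤n⇒m≤1+n i≤n))) (f≡g (suc n) ℕP.≤-refl)

  sumTo-distrib-+ : ∀ n (f g : ℕ → ℤ) → sumTo n (λ i → f i + g i) ≡ sumTo n f + sumTo n g
  sumTo-distrib-+ zero    f g = refl
  sumTo-distrib-+ (suc n) f g =
    trans (cong (_+ (f (suc n) + g (suc n))) (sumTo-distrib-+ n f g)) (interchange (sumTo n f) (sumTo n g) _ _)
    where
    interchange : ∀ a b c d → (a + b) + (c + d) ≡ (a + c) + (b + d)
    interchange = solve-∀

  sumTo-distrib-minus : ∀ n (f g : ℕ → ℤ) → sumTo n (λ i → f i - g i) ≡ sumTo n f - sumTo n g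
  sumTo-distrib-minus zero    f g = refl
  sumTo-distrib-minus (suc n) f g =
    trans (cong (_+ (f (suc n) - g (suc n))) (sumTo-distrib-minus n f g)) (interchange (sumTo n f) (sumTo n g) _ _)
    where
    interchange : ∀ a b c d → (a - b) + (c - d) ≡ (a + c) - (b + d)
    interchange = solve-∀

  sumTo-*ˡ : ∀ n c (f : ℕ → ℤ) → sumTo n (λ i → c * f i) ≡ c * sumTo n f
  sumTo-*ˡ zero    c f = refl
  sumTo-*ˡ (suc n) c f =
    trans (cong (_+ (c * f (suc n))) (sumTo-*ˡ n c f)) (sym (ℤP.*-distribˡ-+ c (sumTo n f) _))

  sumTo-zero : ∀ n (f : ℕ → ℤ) → (∀ i → f i ≡ + 0) → sumTo n f ≡ + 0
  sumTo-zero zero    f f≡0 = f≡0 0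
  sumTo-zero (suc n) f f≡0 = cong₂ _+_ (sumTo-zero n f f≡0) (f≡0 (suc n))

  sumTo-sucˡ : ∀ n (f : ℕ → ℤ) → sumTo (suc n) f ≡ f 0 + sumTo n (f ∘ suc)
  sumTo-sucˡ zero    f = refl
  sumTo-sucˡ (suc n) f =
    trans (cong (_+ f (suc (suc n))) (sumTo-sucˡ n f)) (ℤP.+-assoc (f 0) _ _)

  sumTo-reverse : ∀ n (f : ℕ → ℤ) → sumTo n f ≡ sumTo n (λ i → f (n ∸ i))
  sumTo-reverse zero    f = refl
  sumTo-reverse (suc n) f = sym (begin
    sumTo (suc n) (λ i → f (suc n ∸ i))   ≡⟨ sumTo-sucˡ n _ ⟩
    f (suc n) + sumTo n (λ i → f (n ∸ i)) ≡⟨ cong (λ x → f (suc n) + x) (sym (sumTo-reverse n f)) ⟩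
    f (suc n) + sumTo n f                 ≡⟨ ℤP.+-comm (f (suc n)) _ ⟩
    sumTo n f + f (suc n)                 ∎)
    where open ≡-Reasoning

  ⊛-cong : ∀ {f f′ g g′} → f ≗ f′ → g ≗ g′ → f ⊛ g ≗ f′ ⊛ g′
  ⊛-cong f≗f′ g≗g′ n = sumTo-cong n λ i _ → cong₂ _*_ (f≗f′ i) (g≗g′ (n ∸ i))

  ⊛-congˡ : ∀ {f f′} g → f ≗ f′ → f ⊛ g ≗ f′ ⊛ g
  ⊛-congˡ g f≗f′ = ⊛-cong {g = g} f≗f′ (λ _ → refl)

  ⊛-congʳ : ∀ f {g g′} → g ≗ g′ → f ⊛ g ≗ f ⊛ g′
  ⊛-congʳ f = ⊛-cong {f = f} (λ _ → refl)

  ⊛-comm : ∀ f g → f ⊛ g ≗ g ⊛ f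
  ⊛-comm f g n = trans (sumTo-reverse n _) (sumTo-cong n λ i i≤n →
    trans (ℤP.*-comm (f (n ∸ i)) _) (cong (λ k → g k * f (n ∸ i)) (ℕP.m∸[m∸n]≡n i≤n)))

  ⊛-suc : ∀ f g n → (f ⊛ g) (suc n) ≡ f 0 * g (suc n) + (shift f ⊛ g) n
  ⊛-suc f g n = sumTo-sucˡ n _

  ⊛-distribʳ-⊕ : ∀ f g h → (f ⊕ g) ⊛ h ≗ (f ⊛ h) ⊕ (g ⊛ h)
  ⊛-distribʳ-⊕ f g h n =
    trans (sumTo-cong n λ i _ → ℤP.*-distribʳ-+ (h (n ∸ i)) (f i) (g i)) (sumTo-distrib-+ n _ _)

  ⊛-distribˡ-⊝ : ∀ f g h → f ⊛ (g ⊝ h) ≗ (f ⊛ g) ⊝ (f ⊛ h)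
  ⊛-distribˡ-⊝ f g h n =
    trans (sumTo-cong n λ i _ → distrib (f i) (g (n ∸ i)) (h (n ∸ i))) (sumTo-distrib-minus n _ _)
    where
    distrib : ∀ a b c → a * (b - c) ≡ a * b - a * c
    distrib = solve-∀

  ⊛-·ˡ : ∀ c f h → (c · f) ⊛ h ≗ c · (f ⊛ h)
  ⊛-·ˡ c f h n = trans (sumTo-cong n λ i _ → ℤP.*-assoc c (f i) _) (sumTo-*ˡ n c _)

  ⊛-zeroˡ : ∀ f g → (∀ i → f i ≡ + 0) → f ⊛ g ≗ λ _ → + 0
  ⊛-zeroˡ f g f≡0 n = sumTo-zero n _ λ i → cong (_* g (n ∸ i)) (f≡0 i)

  ⊛-identityˡ : ∀ g → oneS ⊛ g ≗ g
  ⊛-identityˡ g zero    = ℤP.*-identityˡ (g 0)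
  ⊛-identityˡ g (suc n) = begin
    (oneS ⊛ g) (suc n)                      ≡⟨ ⊛-suc oneS g n ⟩
    + 1 * g (suc n) + (shift oneS ⊛ g) n    ≡⟨ cong₂ _+_ (ℤP.*-identityˡ (g (suc n))) (⊛-zeroˡ (shift oneS) g (λ _ → refl) n) ⟩
    g (suc n) + + 0                         ≡⟨ ℤP.+-identityʳ _ ⟩
    g (suc n)                               ∎
    where open ≡-Reasoning

  ⊛-assoc : ∀ f g h → (f ⊛ g) ⊛ h ≗ f ⊛ (g ⊛ h)
  ⊛-assoc f g h zero    = ℤP.*-assoc (f 0) (g 0) (h 0)
  ⊛-assoc f g h (suc n) = begin
    ((f ⊛ g) ⊛ h) (suc n)
      ≡⟨ ⊛-suc (f ⊛ g) h n ⟩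
    f₀g₀ * h (suc n) + (shift (f ⊛ g) ⊛ h) n
      ≡⟨ cong (λ x → f₀g₀ * h (suc n) + x) (⊛-congˡ h (⊛-suc f g) n) ⟩
    f₀g₀ * h (suc n) + (((f 0 · shift g) ⊕ (shift f ⊛ g)) ⊛ h) n
      ≡⟨ cong (λ x → f₀g₀ * h (suc n) + x) (⊛-distribʳ-⊕ (f 0 · shift g) (shift f ⊛ g) h n) ⟩
    f₀g₀ * h (suc n) + (((f 0 · shift g) ⊛ h) n + ((shift f ⊛ g) ⊛ h) n)
      ≡⟨ cong₂ (λ a b → f₀g₀ * h (suc n) + (a + b)) (⊛-·ˡ (f 0) (shift g) h n) (⊛-assoc (shift f) g h n) ⟩
    f₀g₀ * h (suc n) + (f 0 * (shift g ⊛ h) n + (shift f ⊛ (g ⊛ h)) n)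
      ≡⟨ regroup (f 0) (g 0) (h (suc n)) _ _ ⟩
    f 0 * (g 0 * h (suc n) + (shift g ⊛ h) n) + (shift f ⊛ (g ⊛ h)) n
      ≡⟨ cong (λ a → f 0 * a + (shift f ⊛ (g ⊛ h)) n) (sym (⊛-suc g h n)) ⟩
    f 0 * (g ⊛ h) (suc n) + (shift f ⊛ (g ⊛ h)) n
      ≡⟨ sym (⊛-suc f (g ⊛ h) n) ⟩
    (f ⊛ (g ⊛ h)) (suc n) ∎
    where
    open ≡-Reasoning
    f₀g₀ = f 0 * g 0
    regroup : ∀ a b c x y → (a * b) * c + (a * x + y) ≡ a * (b * c + x) + y
    regroup = solve-∀

  ⊛-interchange : ∀ a b c d → (a ⊛ b) ⊛ (c ⊛ d) ≗ (a ⊛ c) ⊛ (b ⊛ d)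
  ⊛-interchange a b c d n = begin
    ((a ⊛ b) ⊛ (c ⊛ d)) n ≡⟨ ⊛-assoc a b (c ⊛ d) n ⟩
    (a ⊛ (b ⊛ (c ⊛ d))) n ≡⟨ ⊛-congʳ a (λ k → sym (⊛-assoc b c d k)) n ⟩
    (a ⊛ ((b ⊛ c) ⊛ d)) n ≡⟨ ⊛-congʳ a (⊛-congˡ d (⊛-comm b c)) n ⟩
    (a ⊛ ((c ⊛ b) ⊛ d)) n ≡⟨ ⊛-congʳ a (⊛-assoc c b d) n ⟩
    (a ⊛ (c ⊛ (b ⊛ d))) n ≡⟨ sym (⊛-assoc a c (b ⊛ d) n) ⟩
    ((a ⊛ c) ⊛ (b ⊛ d)) n ∎
    where open ≡-Reasoning

  ^S-cong : ∀ {f g} k → f ≗ g → f ^S k ≗ g ^S k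
  ^S-cong zero    f≗g n = refl
  ^S-cong (suc k) f≗g   = ⊛-cong f≗g (^S-cong k f≗g)

  ^S-distrib-⊛ : ∀ f g k → (f ⊛ g) ^S k ≗ (f ^S k) ⊛ (g ^S k)
  ^S-distrib-⊛ f g zero    n = sym (⊛-identityˡ oneS n)
  ^S-distrib-⊛ f g (suc k) n =
    trans (⊛-congʳ (f ⊛ g) (^S-distrib-⊛ f g k) n) (⊛-interchange f g (f ^S k) (g ^S k) n)

  ^S-+ : ∀ f a b → f ^S (a ℕ.+ b) ≗ (f ^S a) ⊛ (f ^S b)
  ^S-+ f zero    b n = sym (⊛-identityˡ (f ^S b) n)
  ^S-+ f (suc a) b n = trans (⊛-congʳ f (^S-+ f a b) n) (sym (⊛-assoc f (f ^S a) (f ^S b) n))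

  m+n-n≡m : ∀ a b → (a + b) - b ≡ a
  m+n-n≡m = solve-∀

  1-t : FPS
  1-t = oneS ⊝ tS

  1-t⊛-suc : ∀ x n → (1-t ⊛ x) (suc n) ≡ x (suc n) - x n
  1-t⊛-suc x zero = begin
    + 1 * x 1 + (- + 1) * x 0 ≡⟨ difference (x 1) (x 0) ⟩
    x 1 - x 0                 ∎
    where
    open ≡-Reasoning
    difference : ∀ a b → + 1 * a + (- + 1) * b ≡ a - b
    difference = solve-∀
  1-t⊛-suc x (suc n) = begin
    (1-t ⊛ x) (suc (suc n))
      ≡⟨ ⊛-suc 1-t x (suc n) ⟩
    + 1 * x (suc (suc n)) + (shift 1-t ⊛ x) (suc n)
      ≡⟨ cong (λ y → + 1 * x (suc (suc n)) + y) (⊛-suc (shift 1-t) x n) ⟩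
    + 1 * x (suc (suc n)) + ((- + 1) * x (suc n) + (shift (shift 1-t) ⊛ x) n)
      ≡⟨ cong (λ y → + 1 * x (suc (suc n)) + ((- + 1) * x (suc n) + y))
              (⊛-zeroˡ (shift (shift 1-t)) x (λ _ → refl) n) ⟩
    + 1 * x (suc (suc n)) + ((- + 1) * x (suc n) + + 0)
      ≡⟨ difference (x (suc (suc n))) (x (suc n)) ⟩
    x (suc (suc n)) - x (suc n) ∎
    where
    open ≡-Reasoning
    difference : ∀ a b → + 1 * a + ((- + 1) * b + + 0) ≡ a - b
    difference = solve-∀

  ones⁺ : FPS
  ones⁺ zero    = + 0
  ones⁺ (suc _) = + 1

  naturals : FPS
  naturals n = + n

  ones⁺⊛1-t≗t : ones⁺ ⊛ 1-t ≗ tS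
  ones⁺⊛1-t≗t n = trans (⊛-comm ones⁺ 1-t n) (telescope n)
    where
    telescope : ∀ n → (1-t ⊛ ones⁺) n ≡ tS n
    telescope zero          = refl
    telescope (suc zero)    = 1-t⊛-suc ones⁺ 0
    telescope (suc (suc n)) = 1-t⊛-suc ones⁺ (suc n)

  naturals⊛1-t≗ones⁺ : naturals ⊛ 1-t ≗ ones⁺
  naturals⊛1-t≗ones⁺ n = trans (⊛-comm naturals 1-t n) (telescope n)
    where
    telescope : ∀ n → (1-t ⊛ naturals) n ≡ ones⁺ n
    telescope zero    = refl
    telescope (suc n) = trans (1-t⊛-suc naturals n) (trans (cong (_- + n) (sym (ℤP.pos-+ 1 n))) (m+n-n≡m (+ 1) (+ n)))

  ^S-⊛-1-t : ∀ {f g} m → f ⊛ 1-t ≗ g → (f ^S m) ⊛ (1-t ^S m) ≗ g ^S m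
  ^S-⊛-1-t {f} {g} m f⊛1-t≗g n = trans (sym (^S-distrib-⊛ f 1-t m n)) (^S-cong m f⊛1-t≗g n)

  ^S-double : ∀ f m → f ^S (2 ℕ.* m) ≗ (f ^S m) ⊛ (f ^S m)
  ^S-double f m n = trans (cong (λ k → (f ^S (m ℕ.+ k)) n) (ℕP.+-identityʳ m)) (^S-+ f m m n)

  module _ (m : ℕ) where

    ones⁺^m⊛1-t^2m : (ones⁺ ^S m) ⊛ (1-t ^S (2 ℕ.* m)) ≗ (tS ^S m) ⊛ (1-t ^S m)
    ones⁺^m⊛1-t^2m n = begin
      ((ones⁺ ^S m) ⊛ (1-t ^S (2 ℕ.* m))) n         ≡⟨ ⊛-congʳ (ones⁺ ^S m) (^S-double 1-t m) n ⟩
      ((ones⁺ ^S m) ⊛ ((1-t ^S m) ⊛ (1-t ^S m))) n  ≡⟨ sym (⊛-assoc (ones⁺ ^S m) (1-t ^S m) (1-t ^S m) n) ⟩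
      (((ones⁺ ^S m) ⊛ (1-t ^S m)) ⊛ (1-t ^S m)) n  ≡⟨ ⊛-congˡ (1-t ^S m) (^S-⊛-1-t m ones⁺⊛1-t≗t) n ⟩
      ((tS ^S m) ⊛ (1-t ^S m)) n                    ∎
      where open ≡-Reasoning

    naturals^m⊛1-t^2m : (naturals ^S m) ⊛ (1-t ^S (2 ℕ.* m)) ≗ tS ^S m
    naturals^m⊛1-t^2m n = begin
      ((naturals ^S m) ⊛ (1-t ^S (2 ℕ.* m))) n         ≡⟨ ⊛-congʳ (naturals ^S m) (^S-double 1-t m) n ⟩
      ((naturals ^S m) ⊛ ((1-t ^S m) ⊛ (1-t ^S m))) n  ≡⟨ sym (⊛-assoc (naturals ^S m) (1-t ^S m) (1-t ^S m) n) ⟩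
      (((naturals ^S m) ⊛ (1-t ^S m)) ⊛ (1-t ^S m)) n  ≡⟨ ⊛-congˡ (1-t ^S m) (^S-⊛-1-t m naturals⊛1-t≗ones⁺) n ⟩
      ((ones⁺ ^S m) ⊛ (1-t ^S m)) n                    ≡⟨ ^S-⊛-1-t m ones⁺⊛1-t≗t n ⟩
      (tS ^S m) n                                      ∎
      where open ≡-Reasoning

    solve-A≗L⊕M⊛A : ∀ A L M → L ≗ ones⁺ ^S m → M ≗ naturals ^S m → A ≗ L ⊕ (M ⊛ A) →
                    A ⊛ ((1-t ^S (2 ℕ.* m)) ⊝ (tS ^S m)) ≗ (tS ^S m) ⊛ (1-t ^S m)
    solve-A≗L⊕M⊛A A L M L≗ M≗ A≗ n = begin
      (A ⊛ (Q ⊝ tᵐ)) n                      ≡⟨ ⊛-distribˡ-⊝ A Q tᵐ n ⟩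
      (A ⊛ Q) n - (A ⊛ tᵐ) n                ≡⟨ cong (_- (A ⊛ tᵐ) n) A⊛Q ⟩
      ((tᵐ ⊛ (1-t ^S m)) n + (A ⊛ tᵐ) n) - (A ⊛ tᵐ) n ≡⟨ m+n-n≡m _ ((A ⊛ tᵐ) n) ⟩
      (tᵐ ⊛ (1-t ^S m)) n                   ∎
      where
      open ≡-Reasoning
      Q  = 1-t ^S (2 ℕ.* m)
      tᵐ = tS ^S m
      A⊛Q : (A ⊛ Q) n ≡ (tᵐ ⊛ (1-t ^S m)) n + (A ⊛ tᵐ) n
      A⊛Q = begin
        (A ⊛ Q) n                          ≡⟨ ⊛-congˡ Q A≗ n ⟩
        ((L ⊕ (M ⊛ A)) ⊛ Q) n              ≡⟨ ⊛-distribʳ-⊕ L (M ⊛ A) Q n ⟩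
        (L ⊛ Q) n + ((M ⊛ A) ⊛ Q) n        ≡⟨ cong₂ _+_ (trans (⊛-congˡ Q L≗ n) (ones⁺^m⊛1-t^2m n))
                                                        (⊛-congˡ Q (⊛-comm M A) n) ⟩
        (tᵐ ⊛ (1-t ^S m)) n + ((A ⊛ M) ⊛ Q) n ≡⟨ cong (λ x → (tᵐ ⊛ (1-t ^S m)) n + x) (trans (⊛-assoc A M Q n)
                                                  (⊛-congʳ A (λ k → trans (⊛-congˡ Q M≗ k) (naturals^m⊛1-t^2m k)) n)) ⟩
        (tᵐ ⊛ (1-t ^S m)) n + (A ⊛ tᵐ) n   ∎

open PowerSeries

∈-concatMap⁺′ : ∀ {A B : Set} (F : A → List B) {x xs y} → x ∈ xs → y ∈ F x → y ∈ concatMap F xs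
∈-concatMap⁺′ F x∈ y∈ = ∈-concatMap⁺ F (lose x∈ y∈)

∈-concatMap⁻′ : ∀ {A B : Set} (F : A → List B) xs {y} → y ∈ concatMap F xs → Σ A λ x → x ∈ xs × y ∈ F x
∈-concatMap⁻′ F xs y∈ = find (∈-concatMap⁻ F y∈)

length-concatMap : ∀ {A B : Set} (F : A → List B) xs → length (concatMap F xs) ≡ sum (map (length ∘ F) xs)
length-concatMap F []       = refl
length-concatMap F (x ∷ xs) = trans (LP.length-++ (F x)) (cong (length (F x) ℕ.+_) (length-concatMap F xs))

concatMap-unique : ∀ {A B : Set} (F : A → List B) (key : B → A) {xs} → Unique xs →
                   (∀ x → Unique (F x)) → (∀ x b → b ∈ F x → key b ≡ x) → Unique (concatMap F xs)
concatMap-unique F key {[]}     _           _      _   = []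
concatMap-unique F key {x ∷ xs} (x∉ ∷ uxs) unique key≡ =
  UniqueP.++⁺ (unique x) (concatMap-unique F key uxs unique key≡) disjoint
  where
  disjoint : ∀ {b} → ¬ (b ∈ F x × b ∈ concatMap F xs)
  disjoint (b∈Fx , b∈rest) with ∈-concatMap⁻′ F xs b∈rest
  ... | y , y∈xs , b∈Fy = AllP.All¬⇒¬Any x∉ (subst (_∈ xs) (trans (sym (key≡ y _ b∈Fy)) (key≡ x _ b∈Fx)) y∈xs)

AllPairs-map⁺ : ∀ {A B : Set} {P : A → Set} {R : A → A → Set} {R′ : B → B → Set} (f : A → B) →
                (∀ {x y} → P x → P y → R x y → R′ (f x) (f y)) → ∀ {xs} → All P xs → AllPairs R xs →
                AllPairs R′ (map f xs)
AllPairs-map⁺ f R⇒R′ []         []           = []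
AllPairs-map⁺ f R⇒R′ (Px ∷ Pxs) (Rx ∷ Rxs) = related Pxs Rx ∷ AllPairs-map⁺ f R⇒R′ Pxs Rxs
  where
  related : ∀ {ys} → All _ ys → All _ ys → All _ (map f ys)
  related []         []         = []
  related (Py ∷ Pys) (Rxy ∷ Rxys) = R⇒R′ Px Py Rxy ∷ related Pys Rxys

sum-map-const : ∀ {A : Set} c (xs : List A) → sum (map (λ _ → c) xs) ≡ length xs ℕ.* c
sum-map-const c []       = refl
sum-map-const c (x ∷ xs) = cong (c ℕ.+_) (sum-map-const c xs)

sum-map-*ˡ : ∀ {A : Set} c (g : A → ℕ) xs → sum (map (λ x → c ℕ.* g x) xs) ≡ c ℕ.* sum (map g xs)
sum-map-*ˡ c g []       = sym (ℕP.*-zeroʳ c)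
sum-map-*ˡ c g (x ∷ xs) = trans (cong (c ℕ.* g x ℕ.+_) (sum-map-*ˡ c g xs)) (sym (ℕP.*-distribˡ-+ c (g x) _))

sum-map-+ : ∀ {A : Set} (f g : A → ℕ) xs → sum (map (λ x → f x ℕ.+ g x) xs) ≡ sum (map f xs) ℕ.+ sum (map g xs)
sum-map-+ f g []       = refl
sum-map-+ f g (x ∷ xs) =
  trans (cong (f x ℕ.+ g x ℕ.+_) (sum-map-+ f g xs)) (ℕ-+-interchange (f x) (g x) _ _)

sum-map-concatMap : ∀ {A B : Set} (g : B → ℕ) (F : A → List B) xs →
                    sum (map g (concatMap F xs)) ≡ sum (map (λ x → sum (map g (F x))) xs)
sum-map-concatMap g F []       = refl
sum-map-concatMap g F (x ∷ xs) = trans (cong sum (LP.map-++ g (F x) (concatMap F xs)))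
  (trans (sum-++ (map g (F x)) _) (cong (sum (map g (F x)) ℕ.+_) (sum-map-concatMap g F xs)))

pos-sum-upTo : ∀ n (g : ℕ → ℕ) → + sum (map g (upTo (suc n))) ≡ sumTo n (λ i → + g i)
pos-sum-upTo zero    g = cong +_ (ℕP.+-identityʳ (g 0))
pos-sum-upTo (suc n) g = begin
  + sum (map g (upTo (suc (suc n))))             ≡⟨ cong (λ xs → + sum (map g xs)) (sym (LP.applyUpTo-∷ʳ id (suc n))) ⟩
  + sum (map g (upTo (suc n) ++ [ suc n ]))      ≡⟨ cong (+_ ∘ sum) (LP.map-++ g (upTo (suc n)) [ suc n ]) ⟩
  + sum (map g (upTo (suc n)) ++ [ g (suc n) ])  ≡⟨ cong +_ (sum-++ (map g (upTo (suc n))) [ g (suc n) ]) ⟩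
  + (sum (map g (upTo (suc n))) ℕ.+ (g (suc n) ℕ.+ 0))  ≡⟨ ℤP.pos-+ (sum (map g (upTo (suc n)))) _ ⟩
  + sum (map g (upTo (suc n))) ℤ.+ + (g (suc n) ℕ.+ 0) ≡⟨ cong₂ ℤ._+_ (pos-sum-upTo n g) (cong +_ (ℕP.+-identityʳ _)) ⟩
  sumTo (suc n) (λ i → + g i)                    ∎
  where open ≡-Reasoning

length-unique-≡ : ∀ {A : Set} {xs ys : List A} → Unique xs → Unique ys → (∀ z → z ∈ xs ⇔ z ∈ ys) →
                  length xs ≡ length ys
length-unique-≡ uxs uys xs⇔ys = ↭-length (∼bag⇒↭ (unique∧set⇒bag uxs uys (λ {z} → xs⇔ys z)))

length-deduplicate-≡ : ∀ {A B : Set} (_≟_ : DecidableEquality B) (G : A → B) → (∀ {a b} → G a ≡ G b → a ≡ b) →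
                       (xs : List B) (ys : List A) → Unique ys → (∀ z → z ∈ xs ⇔ z ∈ map G ys) →
                       length (L.deduplicate _≟_ xs) ≡ length ys
length-deduplicate-≡ _≟_ G G-inj xs ys uys xs⇔Gys = trans
  (length-unique-≡ (UniqueDecP.deduplicate-! _≟_ xs) (UniqueP.map⁺ G-inj uys) λ z → mk⇔
    (λ z∈ → Equivalence.to (xs⇔Gys z) (∈-deduplicate⁻ _≟_ xs z∈))
    (λ z∈ → ∈-deduplicate⁺ _≟_ (Equivalence.from (xs⇔Gys z) z∈)))
  (LP.length-map G ys)

-- Boxes of lattice points

interval : ℕ → ℕ → List ℕ
interval p w = applyUpTo (p ℕ.+_) (suc w)

interval⁻ : ∀ p w {x} → x ∈ interval p w → p ≤ x × x ≤ p ℕ.+ w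
interval⁻ p w x∈ with ∈-applyUpTo⁻ (p ℕ.+_) x∈
... | i , s≤s i≤w , refl = ℕP.m≤m+n p i , ℕP.+-monoʳ-≤ p i≤w

interval⁺ : ∀ p w {x} → p ≤ x → x ≤ p ℕ.+ w → x ∈ interval p w
interval⁺ p w {x} p≤x x≤p+w = subst (_∈ interval p w) (ℕP.m+[n∸m]≡n p≤x)
  (∈-applyUpTo⁺ (p ℕ.+_) (s≤s (ℕP.+-cancelˡ-≤ p _ _ (subst (_≤ p ℕ.+ w) (sym (ℕP.m+[n∸m]≡n p≤x)) x≤p+w))))

interval-unique : ∀ p w → Unique (interval p w)
interval-unique p w = UniqueP.applyUpTo⁺₁ (p ℕ.+_) (suc w) λ i<j _ eq → ℕP.<⇒≢ i<j (ℕP.+-cancelˡ-≡ p _ _ eq)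

length-interval : ∀ p w → length (interval p w) ≡ suc w
length-interval p w = LP.length-applyUpTo (p ℕ.+_) (suc w)

-- The box with lowest corner P and side lengths W + 1.
InBox : ∀ {k} → Vec ℕ k → Vec ℕ k → Vec ℕ k → Set
InBox []      []      []      = ⊤
InBox (p ∷ P) (w ∷ W) (x ∷ y) = (p ≤ x × x ≤ p ℕ.+ w) × InBox P W y

boxPoints : ∀ {k} → Vec ℕ k → Vec ℕ k → List (Vec ℕ k)
boxPoints []      []      = [ [] ]
boxPoints (p ∷ P) (w ∷ W) = concatMap (λ x → map (x ∷_) (boxPoints P W)) (interval p w)

boxPoints⁻ : ∀ {k} (P W : Vec ℕ k) {y} → y ∈ boxPoints P W → InBox P W y
boxPoints⁻ []      []      (here refl) = tt
boxPoints⁻ (p ∷ P) (w ∷ W) y∈ with ∈-concatMap⁻′ (λ x → map (x ∷_) (boxPoints P W)) (interval p w) y∈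
... | x , x∈ , y∈′ with ∈-map⁻ (x ∷_) y∈′
... | y , y∈″ , refl = interval⁻ p w x∈ , boxPoints⁻ P W y∈″

boxPoints⁺ : ∀ {k} (P W : Vec ℕ k) {y} → InBox P W y → y ∈ boxPoints P W
boxPoints⁺ []      []      {[]}    tt              = here refl
boxPoints⁺ (p ∷ P) (w ∷ W) {x ∷ y} ((p≤x , x≤) , y∈) =
  ∈-concatMap⁺′ (λ x → map (x ∷_) (boxPoints P W)) (interval⁺ p w p≤x x≤) (∈-map⁺ (x ∷_) (boxPoints⁺ P W y∈))

∷-injectiveʳ : ∀ {A : Set} {k} {x : A} {a b : Vec A k} → (Vec A (suc k) ∋ x ∷ a) ≡ x ∷ b → a ≡ b
∷-injectiveʳ refl = refl

boxPoints-unique : ∀ {k} (P W : Vec ℕ k) → Unique (boxPoints P W)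
boxPoints-unique []      []      = [] ∷ []
boxPoints-unique (p ∷ P) (w ∷ W) =
  concatMap-unique (λ x → map (x ∷_) (boxPoints P W)) V.head (interval-unique p w)
    (λ x → UniqueP.map⁺ ∷-injectiveʳ (boxPoints-unique P W)) head≡
  where
  head≡ : ∀ x b → b ∈ map (x ∷_) (boxPoints P W) → V.head b ≡ x
  head≡ x b b∈ with ∈-map⁻ (x ∷_) b∈
  ... | _ , _ , refl = refl

volume : ∀ {k} → Vec ℕ k → ℕ
volume []      = 1
volume (w ∷ W) = suc w ℕ.* volume W

sideSum : ∀ {k} → Vec ℕ k → ℕ
sideSum []      = 0
sideSum (w ∷ W) = suc w ℕ.+ sideSum W

length-boxPoints : ∀ {k} (P W : Vec ℕ k) → length (boxPoints P W) ≡ volume W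
length-boxPoints []      []      = refl
length-boxPoints (p ∷ P) (w ∷ W) = begin
  length (concatMap F (interval p w))            ≡⟨ length-concatMap F (interval p w) ⟩
  sum (map (length ∘ F) (interval p w))          ≡⟨ cong sum (LP.map-cong length-F (interval p w)) ⟩
  sum (map (λ _ → volume W) (interval p w))      ≡⟨ sum-map-const _ (interval p w) ⟩
  length (interval p w) ℕ.* volume W             ≡⟨ cong (ℕ._* volume W) (length-interval p w) ⟩
  suc w ℕ.* volume W                             ∎
  where
  open ≡-Reasoning
  F = λ x → map (x ∷_) (boxPoints P W)
  length-F : ∀ x → length (F x) ≡ volume W
  length-F x = trans (LP.length-map _ (boxPoints P W)) (length-boxPoints P W)

farCorner : ∀ {k} → Vec ℕ k → Vec ℕ k → Vec ℕ k
farCorner = V.zipWith ℕ._+_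

inBox-corner : ∀ {k} (P W : Vec ℕ k) → InBox P W P
inBox-corner []      []      = tt
inBox-corner (p ∷ P) (w ∷ W) = (ℕP.≤-refl , ℕP.m≤m+n p w) , inBox-corner P W

inBox-farCorner : ∀ {k} (P W : Vec ℕ k) → InBox P W (farCorner P W)
inBox-farCorner []      []      = tt
inBox-farCorner (p ∷ P) (w ∷ W) = (ℕP.m≤m+n p w , ℕP.≤-refl) , inBox-farCorner P W

inBox-lookup : ∀ {k} (P W y : Vec ℕ k) j → InBox P W y →
               lookup P j ≤ lookup y j × lookup y j ≤ lookup P j ℕ.+ lookup W j
inBox-lookup (p ∷ P) (w ∷ W) (x ∷ y) zero    (x∈ , _)  = x∈
inBox-lookup (p ∷ P) (w ∷ W) (x ∷ y) (suc j) (_ , y∈)  = inBox-lookup P W y j y∈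

inBox-lookup⁻ : ∀ {k} (P W : Vec ℕ k) j x → lookup P j ≤ x → x ≤ lookup P j ℕ.+ lookup W j →
                Σ (Vec ℕ k) λ y → InBox P W y × lookup y j ≡ x
inBox-lookup⁻ (p ∷ P) (w ∷ W) zero    x p≤x x≤ = (x ∷ P) , ((p≤x , x≤) , inBox-corner P W) , refl
inBox-lookup⁻ (p ∷ P) (w ∷ W) (suc j) x p≤x x≤ with inBox-lookup⁻ P W j x p≤x x≤
... | y , y∈ , refl = (p ∷ y) , ((ℕP.≤-refl , ℕP.m≤m+n p w) , y∈) , refl

inBox-corners⇒≡ : ∀ {k} (P W P′ W′ : Vec ℕ k) → InBox P W P′ → InBox P′ W′ P →
                  InBox P W (farCorner P′ W′) → InBox P′ W′ (farCorner P W) → P ≡ P′ × W ≡ W′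
inBox-corners⇒≡ [] [] [] [] _ _ _ _ = refl , refl
inBox-corners⇒≡ (p ∷ P) (w ∷ W) (p′ ∷ P′) (w′ ∷ W′) ((p≤p′ , _) , P′∈) ((p′≤p , _) , P∈) ((_ , far′≤) , far′∈) ((_ , far≤) , far∈)
  with ℕP.≤-antisym p≤p′ p′≤p | inBox-corners⇒≡ P W P′ W′ P′∈ P∈ far′∈ far∈
... | refl | refl , refl = cong (p ∷_) refl , cong (_∷ W) (ℕP.+-cancelˡ-≡ p _ _ (ℕP.≤-antisym far≤ far′≤))

-- Directed paths

stepℕ : ∀ {k} → Vec ℕ k → Fin k → Vec ℕ k
stepℕ b j = b V.[ j ]%= suc

data UpPath {k} (S : Vec ℕ k → Set) : Vec ℕ k → Vec ℕ k → Set where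
  here : ∀ {a} → S a → UpPath S a a
  fwd  : ∀ {a b} j → UpPath S a b → S (stepℕ b j) → UpPath S a (stepℕ b j)

UpPath-end : ∀ {k S} {a b : Vec ℕ k} → UpPath S a b → S b
UpPath-end (here b∈)    = b∈
UpPath-end (fwd _ _ b∈) = b∈

UpPath-trans : ∀ {k S} {a b c : Vec ℕ k} → UpPath S a b → UpPath S b c → UpPath S a c
UpPath-trans p (here _)     = p
UpPath-trans p (fwd j q c∈) = fwd j (UpPath-trans p q) c∈

UpPath-mono : ∀ {k} {S S′ : Vec ℕ k → Set} {a b} → (∀ {x} → S x → S′ x) → UpPath S a b → UpPath S′ a b
UpPath-mono S⊆S′ (here a∈)    = here (S⊆S′ a∈)
UpPath-mono S⊆S′ (fwd j p b∈) = fwd j (UpPath-mono S⊆S′ p) (S⊆S′ b∈)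

UpPath-∷ : ∀ {k} {S : Vec ℕ (suc k) → Set} {x a b} → UpPath (λ v → S (x ∷ v)) a b → UpPath S (x ∷ a) (x ∷ b)
UpPath-∷ (here a∈)    = here a∈
UpPath-∷ (fwd j p b∈) = fwd (suc j) (UpPath-∷ p) b∈

UpPath-line : ∀ {k} {S : Vec ℕ (suc k) → Set} (v : Vec ℕ k) x y → x ≤ y →
              (∀ z → x ≤ z → z ≤ y → S (z ∷ v)) → UpPath S (x ∷ v) (y ∷ v)
UpPath-line v zero zero    z≤n  segment = here (segment 0 z≤n z≤n)
UpPath-line v x    (suc y) x≤1+y segment with ℕP.m≤n⇒m<n∨m≡n x≤1+y
... | inj₂ refl = here (segment (suc y) x≤1+y ℕP.≤-refl)
... | inj₁ x<1+y = fwd zero (UpPath-line v x y (ℕP.≤-pred x<1+y) λ z x≤z z≤y → segment z x≤z (ℕP.m≤n⇒m≤1+n z≤y))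
                            (segment (suc y) x≤1+y ℕP.≤-refl)

UpPath-box : ∀ {k} {S : Vec ℕ k → Set} (P W y : Vec ℕ k) → InBox P W y →
             (∀ z → InBox P W z → S z) → UpPath S P y
UpPath-box []      []      []      tt box⊆S = here (box⊆S [] tt)
UpPath-box {S = S} (p ∷ P) (w ∷ W) (x ∷ y) ((p≤x , x≤) , y∈) box⊆S = UpPath-trans
  (UpPath-line P p x p≤x λ z p≤z z≤x → box⊆S (z ∷ P) ((p≤z , ℕP.≤-trans z≤x x≤) , inBox-corner P W))
  (UpPath-∷ (UpPath-box {S = λ v → S (x ∷ v)} P W y y∈ λ z z∈ → box⊆S (x ∷ z) ((p≤x , x≤) , z∈)))

toℤ : ∀ {k} → Vec ℕ k → Vec ℤ k
toℤ = V.map +_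

toℤ-injective : ∀ {k} {x y : Vec ℕ k} → toℤ x ≡ toℤ y → x ≡ y
toℤ-injective {x = []}    {[]}    _  = refl
toℤ-injective {x = a ∷ x} {b ∷ y} eq =
  cong₂ _∷_ (ℤP.+-injective (cong V.head eq)) (toℤ-injective (cong V.tail eq))

step-toℤ : ∀ {k} (b : Vec ℕ k) (j : Fin k) → step (toℤ b) j ≡ toℤ (stepℕ b j)
step-toℤ (x ∷ b) zero    = refl
step-toℤ (x ∷ b) (suc j) = cong (+ x ∷_) (step-toℤ b j)

UpPath⇒DirPath : ∀ {k} {A : CellSet k} {a b} → UpPath (λ v → toℤ v ∈ A) a b → DirPath A (toℤ a) (toℤ b)
UpPath⇒DirPath (here a∈) = here a∈
UpPath⇒DirPath {A = A} {a} (fwd {b = b} j p b∈) = subst (DirPath A (toℤ a)) (step-toℤ b j)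
  (fwd j (UpPath⇒DirPath p) (subst (_∈ A) (sym (step-toℤ b j)) b∈))

DirPath-end : ∀ {d} {A : CellSet d} {a b} → DirPath A a b → b ∈ A
DirPath-end (here b∈)    = b∈
DirPath-end (fwd _ _ b∈) = b∈

Connected-trans : ∀ {d} {A : CellSet d} {a b c} → Connected A a b → Connected A b c → Connected A a c
Connected-trans p (here _)     = p
Connected-trans p (fwd j q c∈) = fwd j (Connected-trans p q) c∈
Connected-trans p (bwd j q c∈) = bwd j (Connected-trans p q) c∈

DirPath⇒Connected : ∀ {d} {A : CellSet d} {a b} → DirPath A a b → Connected A a b
DirPath⇒Connected (here a∈)    = here a∈
DirPath⇒Connected (fwd j p b∈) = fwd j (DirPath⇒Connected p) b∈

backstep-step : ∀ {d} (b : Cell d) j → backstep (step b j) j ≡ b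
backstep-step (x ∷ b) zero    = cong (_∷ b) (ℤP.pred-suc x)
backstep-step (x ∷ b) (suc j) = cong (x ∷_) (backstep-step b j)

DirPath⇒Connected⁻¹ : ∀ {d} {A : CellSet d} {a b} → DirPath A a b → Connected A b a
DirPath⇒Connected⁻¹ (here a∈) = here a∈
DirPath⇒Connected⁻¹ {A = A} (fwd {b = b} j p b+j∈) = Connected-trans
  (subst (Connected A (step b j)) (backstep-step b j)
    (bwd j (here b+j∈) (subst (_∈ A) (sym (backstep-step b j)) (DirPath-end p))))
  (DirPath⇒Connected⁻¹ p)

directed⇒polyhypercube : ∀ {d} {A : CellSet d} → IsDirected A → IsPolyhypercube A
directed⇒polyhypercube (r , r∈ , reach) =
  (r , r∈) , λ a∈ b∈ → Connected-trans (DirPath⇒Connected⁻¹ (reach a∈)) (DirPath⇒Connected (reach b∈))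

-- Translations

zeros : ∀ {k} → Vec ℕ k
zeros = V.replicate _ 0

infixl 6 _+ᵛ_

_+ᵛ_ : ∀ {k} → Vec ℤ k → Vec ℤ k → Vec ℤ k
_+ᵛ_ = V.zipWith ℤ._+_

-ᵛ_ : ∀ {k} → Vec ℤ k → Vec ℤ k
-ᵛ_ = V.map (λ z → ℤ.- z)

translate : ∀ {k} → Vec ℤ k → Vec ℕ k → Vec ℤ k
translate r x = toℤ x +ᵛ r

+ᵛ-identityˡ : ∀ {k} (r : Vec ℤ k) → toℤ zeros +ᵛ r ≡ r
+ᵛ-identityˡ []      = refl
+ᵛ-identityˡ (z ∷ r) = cong₂ _∷_ (ℤP.+-identityˡ z) (+ᵛ-identityˡ r)

+ᵛ-identityʳ : ∀ {k} (c : Vec ℤ k) → c +ᵛ toℤ zeros ≡ c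
+ᵛ-identityʳ []      = refl
+ᵛ-identityʳ (z ∷ c) = cong₂ _∷_ (ℤP.+-identityʳ z) (+ᵛ-identityʳ c)

+ᵛ-inverseˡ : ∀ {k} (v : Vec ℤ k) → (-ᵛ v) +ᵛ v ≡ toℤ zeros
+ᵛ-inverseˡ []      = refl
+ᵛ-inverseˡ (z ∷ v) = cong₂ _∷_ (ℤP.+-inverseˡ z) (+ᵛ-inverseˡ v)

+ᵛ-cancelʳ : ∀ {k} (x r : Vec ℤ k) → x +ᵛ r +ᵛ (-ᵛ r) ≡ x
+ᵛ-cancelʳ []      []      = refl
+ᵛ-cancelʳ (a ∷ x) (z ∷ r) = cong₂ _∷_ (cancel a z) (+ᵛ-cancelʳ x r)
  where
  cancel : ∀ a z → a ℤ.+ z ℤ.+ ℤ.- z ≡ a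
  cancel = solve-∀

-ᵛ-cancelʳ : ∀ {k} (x r : Vec ℤ k) → x +ᵛ (-ᵛ r) +ᵛ r ≡ x
-ᵛ-cancelʳ []      []      = refl
-ᵛ-cancelʳ (a ∷ x) (z ∷ r) = cong₂ _∷_ (cancel a z) (-ᵛ-cancelʳ x r)
  where
  cancel : ∀ a z → a ℤ.+ ℤ.- z ℤ.+ z ≡ a
  cancel = solve-∀

∣toℤ∣ : ∀ {k} (x : Vec ℕ k) → V.map ℤ.∣_∣ (toℤ x) ≡ x
∣toℤ∣ []      = refl
∣toℤ∣ (a ∷ x) = cong (a ∷_) (∣toℤ∣ x)

translate-step : ∀ {k} (r : Vec ℤ k) x j → step (translate r x) j ≡ translate r (stepℕ x j)
translate-step (z ∷ r) (a ∷ x) zero    = cong (_∷ _) (sym (ℤP.+-assoc (+ 1) (+ a) z))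
translate-step (z ∷ r) (a ∷ x) (suc j) = cong (_ ∷_) (translate-step r x j)

translate-injective : ∀ {k} (r : Vec ℤ k) {x y} → translate r x ≡ translate r y → x ≡ y
translate-injective r {x} {y} eq = toℤ-injective (begin
  toℤ x                        ≡⟨ sym (+ᵛ-cancelʳ (toℤ x) r) ⟩
  translate r x +ᵛ (-ᵛ r)      ≡⟨ cong (_+ᵛ (-ᵛ r)) eq ⟩
  translate r y +ᵛ (-ᵛ r)      ≡⟨ +ᵛ-cancelʳ (toℤ y) r ⟩
  toℤ y                        ∎)
  where open ≡-Reasoning

translate-mono⁻ : ∀ {k} (r : Vec ℤ k) (a b : Vec ℕ k) →
                  Pointwise ℤ._≤_ (translate r a) (translate r b) → Pointwise _≤_ a b
translate-mono⁻ []      []      []      []         = []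
translate-mono⁻ (z ∷ r) (a ∷ as) (b ∷ bs) (a≤b ∷ as≤bs) = a≤b′ ∷ translate-mono⁻ r as bs as≤bs
  where
  cancel : ∀ a z → a ℤ.+ z ℤ.+ ℤ.- z ≡ a
  cancel = solve-∀
  a≤b′ : a ≤ b
  a≤b′ with subst₂ ℤ._≤_ (cancel (+ a) z) (cancel (+ b) z) (ℤP.+-monoˡ-≤ (ℤ.- z) a≤b)
  ... | +≤+ a≤b″ = a≤b″

translate-mono⁺ : ∀ {k} (r : Vec ℤ k) (a b : Vec ℕ k) →
                  Pointwise _≤_ a b → Pointwise ℤ._≤_ (translate r a) (translate r b)
translate-mono⁺ []      []       []       []            = []
translate-mono⁺ (z ∷ r) (a ∷ as) (b ∷ bs) (a≤b ∷ as≤bs) = ℤP.+-monoˡ-≤ z (+≤+ a≤b) ∷ translate-mono⁺ r as bs as≤bs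

toℤ-and-neg-toℤ⇒zeros : ∀ {k} (v : Vec ℤ k) y y′ → v ≡ toℤ y → -ᵛ v ≡ toℤ y′ → v ≡ toℤ zeros
toℤ-and-neg-toℤ⇒zeros []              []        []        _    _   = refl
toℤ-and-neg-toℤ⇒zeros (.(+ 0) ∷ v)    (zero ∷ y)  (_ ∷ y′)  refl -v≡ =
  cong (+ 0 ∷_) (toℤ-and-neg-toℤ⇒zeros v y y′ refl (cong V.tail -v≡))
toℤ-and-neg-toℤ⇒zeros (.(+ suc a) ∷ v) (suc a ∷ y) (_ ∷ y′) refl ()

inBox⇒Pointwise : ∀ {k} (lo hi y : Vec ℕ k) → Pointwise _≤_ lo hi → InBox lo (V.zipWith _∸_ hi lo) y →
                  Pointwise _≤_ lo y × Pointwise _≤_ y hi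
inBox⇒Pointwise []       []       []      []            tt = [] , []
inBox⇒Pointwise (p ∷ lo) (q ∷ hi) (x ∷ y) (p≤q ∷ lo≤hi) ((p≤x , x≤) , y∈) with inBox⇒Pointwise lo hi y lo≤hi y∈
... | lo≤y , y≤hi = (p≤x ∷ lo≤y) , (subst (x ≤_) (ℕP.m+[n∸m]≡n p≤q) x≤ ∷ y≤hi)

Pointwise⇒inBox : ∀ {k} (lo hi y : Vec ℕ k) → Pointwise _≤_ lo hi → Pointwise _≤_ lo y → Pointwise _≤_ y hi →
                  InBox lo (V.zipWith _∸_ hi lo) y
Pointwise⇒inBox []       []       []      []            []            []            = tt
Pointwise⇒inBox (p ∷ lo) (q ∷ hi) (x ∷ y) (p≤q ∷ lo≤hi) (p≤x ∷ lo≤y) (x≤q ∷ y≤hi) =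
  (p≤x , subst (x ≤_) (sym (ℕP.m+[n∸m]≡n p≤q)) x≤q) , Pointwise⇒inBox lo hi y lo≤hi lo≤y y≤hi

toℤ-inBox⁻ : ∀ {k} (P W : Vec ℕ k) (e : Vec ℤ k) →
             Pointwise ℤ._≤_ (toℤ P) e → Pointwise ℤ._≤_ e (toℤ (farCorner P W)) →
             Σ (Vec ℕ k) λ y → e ≡ toℤ y × InBox P W y
toℤ-inBox⁻ []      []      []           []              []              = [] , refl , tt
toℤ-inBox⁻ (p ∷ P) (w ∷ W) (.(+ _) ∷ e) (+≤+ p≤x ∷ P≤e) (+≤+ x≤ ∷ e≤) with toℤ-inBox⁻ P W e P≤e e≤
... | y , refl , y∈ = (_ ∷ y) , refl , ((p≤x , x≤) , y∈)

toℤ-inBox⁺ : ∀ {k} (P W y : Vec ℕ k) → InBox P W y →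
             Pointwise ℤ._≤_ (toℤ P) (toℤ y) × Pointwise ℤ._≤_ (toℤ y) (toℤ (farCorner P W))
toℤ-inBox⁺ []      []      []      tt                 = [] , []
toℤ-inBox⁺ (p ∷ P) (w ∷ W) (x ∷ y) ((p≤x , x≤) , y∈) with toℤ-inBox⁺ P W y y∈
... | P≤y , y≤ = (+≤+ p≤x ∷ P≤y) , (+≤+ x≤ ∷ y≤)

translate-∷ : ∀ {k} (r : Vec ℤ (suc k)) x y → translate r (x ∷ y) ≡ (+ x ℤ.+ V.head r) ∷ translate (V.tail r) y
translate-∷ (z ∷ r) x y = refl

tail-translate : ∀ {k} (r : Vec ℤ (suc k)) x → V.tail (translate r x) ≡ translate (V.tail r) (V.tail x)
tail-translate (z ∷ r) (a ∷ x) = refl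

-- Side-length vectors

withFirstSide : ∀ {k} → ℕ → List (Vec ℕ k) → List (Vec ℕ (suc k))
withFirstSide zero    Ws = []
withFirstSide (suc w) Ws = map (w ∷_) Ws

-- i is the length of the first side, which is stored as i ∸ 1; withFirstSide 0 is empty.
widthVectors : (k : ℕ) → ℕ → List (Vec ℕ k)
widthVectors zero    zero    = [ [] ]
widthVectors zero    (suc n) = []
widthVectors (suc k) n       = concatMap (λ i → withFirstSide i (widthVectors k (n ∸ i))) (upTo (suc n))

widthVectors⁻ : ∀ k n {W} → W ∈ widthVectors k n → sideSum W ≡ n
widthVectors⁻ zero    zero (here refl) = refl
widthVectors⁻ (suc k) n    W∈ with ∈-concatMap⁻′ (λ i → withFirstSide i (widthVectors k (n ∸ i))) (upTo (suc n)) W∈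
... | zero  , _    , ()
... | suc w , i∈ , W∈′ with ∈-map⁻ (w ∷_) W∈′
... | W , W∈″ , refl =
  trans (cong (suc w ℕ.+_) (widthVectors⁻ k (n ∸ suc w) W∈″)) (ℕP.m+[n∸m]≡n (ℕP.≤-pred (∈-upTo⁻ i∈)))

widthVectors⁺ : ∀ k {W : Vec ℕ k} → W ∈ widthVectors k (sideSum W)
widthVectors⁺ zero    {[]}    = here refl
widthVectors⁺ (suc k) {w ∷ W} = ∈-concatMap⁺′ (λ i → withFirstSide i (widthVectors k ((suc w ℕ.+ sideSum W) ∸ i)))
  (∈-upTo⁺ (s≤s (ℕP.m≤m+n (suc w) (sideSum W))))
  (∈-map⁺ (w ∷_) (subst (λ n → W ∈ widthVectors k n) (sym (ℕP.m+n∸m≡n (suc w) (sideSum W))) (widthVectors⁺ k)))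

widthVectors-unique : ∀ k n → Unique (widthVectors k n)
widthVectors-unique zero    zero    = [] ∷ []
widthVectors-unique zero    (suc n) = []
widthVectors-unique (suc k) n =
  concatMap-unique (λ i → withFirstSide i (widthVectors k (n ∸ i))) (λ W → suc (V.head W)) (UniqueP.upTo⁺ (suc n))
    (λ { zero → [] ; (suc w) → UniqueP.map⁺ ∷-injectiveʳ (widthVectors-unique k (n ∸ suc w)) })
    (λ { zero _ () ; (suc w) _ W∈ → first+1≡ W∈ })
  where
  first+1≡ : ∀ {w : ℕ} {Ws : List (Vec ℕ k)} {W} → W ∈ map (w ∷_) Ws → suc (V.head W) ≡ suc w
  first+1≡ {w} W∈ with ∈-map⁻ (w ∷_) W∈
  ... | _ , _ , refl = refl

boxCount : ℕ → ℕ → ℕ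
boxCount k n = length (widthVectors k n)

pointedBoxCount : ℕ → ℕ → ℕ
pointedBoxCount k n = sum (map volume (widthVectors k n))

boxCount-series : ∀ k → (λ n → + boxCount k n) ≗ ones⁺ ^S k
boxCount-series zero    zero    = refl
boxCount-series zero    (suc n) = refl
boxCount-series (suc k) n = begin
  + length (concatMap F (upTo (suc n)))                   ≡⟨ cong +_ (length-concatMap F (upTo (suc n))) ⟩
  + sum (map (length ∘ F) (upTo (suc n)))                 ≡⟨ pos-sum-upTo n (length ∘ F) ⟩
  sumTo n (λ i → + length (F i))                          ≡⟨ sumTo-cong n (λ i _ → term i) ⟩
  (ones⁺ ⊛ (ones⁺ ^S k)) n                                ∎
  where
  open ≡-Reasoning
  F = λ i → withFirstSide i (widthVectors k (n ∸ i))
  term : ∀ i → + length (F i) ≡ ones⁺ i ℤ.* (ones⁺ ^S k) (n ∸ i)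
  term zero    = refl
  term (suc w) = trans (cong +_ (LP.length-map (w ∷_) (widthVectors k (n ∸ suc w))))
                       (trans (boxCount-series k (n ∸ suc w)) (sym (ℤP.*-identityˡ _)))

pointedBoxCount-series : ∀ k → (λ n → + pointedBoxCount k n) ≗ naturals ^S k
pointedBoxCount-series zero    zero    = refl
pointedBoxCount-series zero    (suc n) = refl
pointedBoxCount-series (suc k) n = begin
  + sum (map volume (concatMap F (upTo (suc n))))         ≡⟨ cong +_ (sum-map-concatMap volume F (upTo (suc n))) ⟩
  + sum (map (λ i → sum (map volume (F i))) (upTo (suc n))) ≡⟨ pos-sum-upTo n _ ⟩
  sumTo n (λ i → + sum (map volume (F i)))                ≡⟨ sumTo-cong n (λ i _ → term i) ⟩
  (naturals ⊛ (naturals ^S k)) n                          ∎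
  where
  open ≡-Reasoning
  F = λ i → withFirstSide i (widthVectors k (n ∸ i))
  term : ∀ i → + sum (map volume (F i)) ≡ naturals i ℤ.* (naturals ^S k) (n ∸ i)
  term zero    = refl
  term (suc w) = begin
    + sum (map volume (map (w ∷_) Ws))              ≡⟨ cong (+_ ∘ sum) (sym (LP.map-∘ Ws)) ⟩
    + sum (map (λ W → suc w ℕ.* volume W) Ws)       ≡⟨ cong +_ (sum-map-*ˡ (suc w) volume Ws) ⟩
    + (suc w ℕ.* pointedBoxCount k (n ∸ suc w))     ≡⟨ ℤP.pos-* (suc w) _ ⟩
    + suc w ℤ.* + pointedBoxCount k (n ∸ suc w)     ≡⟨ cong (+ suc w ℤ.*_) (pointedBoxCount-series k (n ∸ suc w)) ⟩
    + suc w ℤ.* (naturals ^S k) (n ∸ suc w)         ∎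
    where Ws = widthVectors k (n ∸ suc w)

-- Plateau shapes

module Shapes (m : ℕ) where

  Box : Set
  Box = Vec ℕ m × Vec ℕ m

  -- The successive strata, from bottom to top.
  Shape : Set
  Shape = List Box

  cellsFrom : ℕ → Shape → List (Vec ℕ (suc m))
  cellsFrom h []            = []
  cellsFrom h ((P , W) ∷ s) = map (h ∷_) (boxPoints P W) ++ cellsFrom (suc h) s

  cells : Shape → CellSet (suc m)
  cells s = map toℤ (cellsFrom 0 s)

  cellsFrom-head : ∀ h s {x} → x ∈ cellsFrom h s → h ≤ V.head x
  cellsFrom-head h ((P , W) ∷ s) x∈ with ∈-++⁻ (map (h ∷_) (boxPoints P W)) x∈
  ... | inj₂ x∈above = ℕP.<⇒≤ (cellsFrom-head (suc h) s x∈above)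
  ... | inj₁ x∈here with ∈-map⁻ (h ∷_) x∈here
  ... | _ , _ , refl = ℕP.≤-refl

  cellsFrom⁻ : ∀ h B s {x} → x ∈ cellsFrom h (B ∷ s) →
               (Σ (Vec ℕ m) λ y → x ≡ h ∷ y × InBox (proj₁ B) (proj₂ B) y) ⊎ x ∈ cellsFrom (suc h) s
  cellsFrom⁻ h (P , W) s x∈ with ∈-++⁻ (map (h ∷_) (boxPoints P W)) x∈
  ... | inj₂ x∈above = inj₂ x∈above
  ... | inj₁ x∈here with ∈-map⁻ (h ∷_) x∈here
  ... | y , y∈ , refl = inj₁ (y , refl , boxPoints⁻ P W y∈)

  cellsFrom-stratum⁺ : ∀ h B s {y} → InBox (proj₁ B) (proj₂ B) y → (h ∷ y) ∈ cellsFrom h (B ∷ s)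
  cellsFrom-stratum⁺ h (P , W) s y∈ = ∈-++⁺ˡ (∈-map⁺ (h ∷_) (boxPoints⁺ P W y∈))

  cellsFrom-stratum⁻ : ∀ h B s {y} → (h ∷ y) ∈ cellsFrom h (B ∷ s) → InBox (proj₁ B) (proj₂ B) y
  cellsFrom-stratum⁻ h B s hy∈ with cellsFrom⁻ h B s hy∈
  ... | inj₁ (y , refl , y∈)  = y∈
  ... | inj₂ hy∈above = ⊥-elim (ℕP.<-irrefl refl (cellsFrom-head (suc h) s hy∈above))

  cellsFrom-above⁺ : ∀ h b s {x} → x ∈ cellsFrom (suc h) s → x ∈ cellsFrom h (b ∷ s)
  cellsFrom-above⁺ h (P , W) s = ∈-++⁺ʳ (map (h ∷_) (boxPoints P W))

  cellsFrom-above⁻ : ∀ h b s {x} → x ∈ cellsFrom h (b ∷ s) → V.head x ≢ h → x ∈ cellsFrom (suc h) s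
  cellsFrom-above⁻ h (P , W) s x∈ x₁≢h with cellsFrom⁻ h (P , W) s x∈
  ... | inj₁ (y , refl , _) = ⊥-elim (x₁≢h refl)
  ... | inj₂ x∈above        = x∈above

  cellsFrom-plateau : ∀ h s {x} → x ∈ cellsFrom h s →
                      Σ Box λ (P , W) → ∀ y → ((V.head x ∷ y) ∈ cellsFrom h s) ⇔ InBox P W y
  cellsFrom-plateau h ((P , W) ∷ s) x∈ with cellsFrom⁻ h (P , W) s x∈
  ... | inj₁ (y , refl , _) = (P , W) , λ y′ → mk⇔ (cellsFrom-stratum⁻ h (P , W) s) (cellsFrom-stratum⁺ h (P , W) s)
  ... | inj₂ x∈above with cellsFrom-plateau (suc h) s x∈above
  ... | B , stratum = B , λ y′ → mk⇔
    (λ y′∈ → Equivalence.to (stratum y′)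
      (cellsFrom-above⁻ h (P , W) s y′∈ λ eq → ℕP.<-irrefl (sym eq) (cellsFrom-head (suc h) s x∈above)))
    (λ y′∈ → cellsFrom-above⁺ h (P , W) s (Equivalence.from (stratum y′) y′∈))

  cells-plateau : ∀ s → IsPlateauPoly (cells s)
  cells-plateau s {c} c∈ with ∈-map⁻ toℤ c∈
  ... | (h ∷ x) , x∈ , refl with cellsFrom-plateau 0 s x∈
  ... | (P , W) , stratum = toℤ P , toℤ (farCorner P W) , λ e → mk⇔ (to e) (from e)
    where
    to : ∀ e → (+ h ∷ e) ∈ cells s → Pointwise ℤ._≤_ (toℤ P) e × Pointwise ℤ._≤_ e (toℤ (farCorner P W))
    to e he∈ with ∈-map⁻ toℤ he∈
    ... | (h′ ∷ y) , y∈ , eq with ℤP.+-injective (cong V.head eq) | cong V.tail eq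
    ... | refl | refl = toℤ-inBox⁺ P W y (Equivalence.to (stratum y) y∈)
    from : ∀ e → Pointwise ℤ._≤_ (toℤ P) e × Pointwise ℤ._≤_ e (toℤ (farCorner P W)) → (+ h ∷ e) ∈ cells s
    from e (P≤e , e≤) with toℤ-inBox⁻ P W e P≤e e≤
    ... | y , refl , y∈ = ∈-map⁺ toℤ (Equivalence.from (stratum y) y∈)

  -- Directedness: the corner of each stratum lies in the box of the stratum below.
  data Chain : Vec ℕ m → Shape → Set where
    one  : ∀ {P W} → Chain P ((P , W) ∷ [])
    more : ∀ {P W Q s} → InBox P W Q → Chain Q s → Chain P ((P , W) ∷ s)

  Chain-corner∈ : ∀ {P s} → Chain P s → ∀ h → (h ∷ P) ∈ cellsFrom h s
  Chain-corner∈ (one {P} {W})           h = cellsFrom-stratum⁺ h (P , W) [] (inBox-corner P W)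
  Chain-corner∈ (more {P} {W} {s = s} _ _) h = cellsFrom-stratum⁺ h (P , W) s (inBox-corner P W)

  Chain-UpPath : ∀ {P s} → Chain P s → ∀ h {x} → x ∈ cellsFrom h s → UpPath (_∈ cellsFrom h s) (h ∷ P) x
  Chain-UpPath (one {P} {W}) h x∈ with cellsFrom⁻ h (P , W) [] x∈
  ... | inj₁ (y , refl , y∈) = UpPath-∷ (UpPath-box P W y y∈ λ z z∈ → cellsFrom-stratum⁺ h (P , W) [] z∈)
  Chain-UpPath (more {P} {W} {Q} {s} Q∈ c) h x∈ with cellsFrom⁻ h (P , W) s x∈
  ... | inj₁ (y , refl , y∈) = UpPath-∷ (UpPath-box P W y y∈ λ z z∈ → cellsFrom-stratum⁺ h (P , W) s z∈)
  ... | inj₂ x∈above = UpPath-trans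
    (fwd zero (UpPath-∷ (UpPath-box P W Q Q∈ λ z z∈ → cellsFrom-stratum⁺ h (P , W) s z∈))
              (cellsFrom-above⁺ h (P , W) s (Chain-corner∈ c (suc h))))
    (UpPath-mono (cellsFrom-above⁺ h (P , W) s) (Chain-UpPath c (suc h) x∈above))

  cells-directed : ∀ {s} → Chain zeros s → IsDirected (cells s)
  cells-directed {s} c = toℤ (0 ∷ zeros) , ∈-map⁺ toℤ (Chain-corner∈ c 0) , reach
    where
    reach : ∀ {c′} → c′ ∈ cells s → DirPath (cells s) (toℤ (0 ∷ zeros)) c′
    reach c′∈ with ∈-map⁻ toℤ c′∈
    ... | x , x∈ , refl = UpPath⇒DirPath (UpPath-mono (∈-map⁺ toℤ) (Chain-UpPath c 0 x∈))

  cells-directedPlateau : ∀ {s} → Chain zeros s → IsDirectedPlateau (cells s)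
  cells-directedPlateau {s} c = directed⇒polyhypercube (cells-directed c) , cells-directed c , cells-plateau s

  shapeArea : Shape → ℕ
  shapeArea []            = 0
  shapeArea ((P , W) ∷ s) = sideSum W ℕ.+ shapeArea s

  -- The projection onto the plane (i₁, i_(j+2)), stratum by stratum.
  projectionFrom : Fin m → ℕ → Shape → List (ℕ × ℕ)
  projectionFrom j h []            = []
  projectionFrom j h ((P , W) ∷ s) = map (h ,_) (interval (lookup P j) (lookup W j)) ++ projectionFrom j (suc h) s

  projectionSize : Fin m → Shape → ℕ
  projectionSize j []            = 0
  projectionSize j ((P , W) ∷ s) = suc (lookup W j) ℕ.+ projectionSize j s

  project : Fin m → Vec ℕ (suc m) → ℕ × ℕ
  project j x = V.head x , lookup (V.tail x) j

  projectionFrom-head : ∀ j h s {w} → w ∈ projectionFrom j h s → h ≤ proj₁ w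
  projectionFrom-head j h ((P , W) ∷ s) w∈ with ∈-++⁻ (map (h ,_) (interval (lookup P j) (lookup W j))) w∈
  ... | inj₂ w∈above = ℕP.<⇒≤ (projectionFrom-head j (suc h) s w∈above)
  ... | inj₁ w∈here with ∈-map⁻ (h ,_) w∈here
  ... | _ , _ , refl = ℕP.≤-refl

  ,-injectiveʳ : ∀ {h a b : ℕ} → (ℕ × ℕ ∋ (h , a)) ≡ (h , b) → a ≡ b
  ,-injectiveʳ refl = refl

  projectionFrom-unique : ∀ j h s → Unique (projectionFrom j h s)
  projectionFrom-unique j h []            = []
  projectionFrom-unique j h ((P , W) ∷ s) = UniqueP.++⁺
    (UniqueP.map⁺ ,-injectiveʳ (interval-unique (lookup P j) (lookup W j))) (projectionFrom-unique j (suc h) s) disjoint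
    where
    disjoint : ∀ {v} → ¬ (v ∈ map (h ,_) (interval (lookup P j) (lookup W j)) × v ∈ projectionFrom j (suc h) s)
    disjoint (v∈here , v∈above) with ∈-map⁻ (h ,_) v∈here
    ... | _ , _ , refl = ℕP.<-irrefl refl (projectionFrom-head j (suc h) s v∈above)

  length-projectionFrom : ∀ j h s → length (projectionFrom j h s) ≡ projectionSize j s
  length-projectionFrom j h []            = refl
  length-projectionFrom j h ((P , W) ∷ s) = trans (LP.length-++ (map (h ,_) I))
    (cong₂ ℕ._+_ (trans (LP.length-map (h ,_) I) (length-interval (lookup P j) (lookup W j)))
                 (length-projectionFrom j (suc h) s))
    where I = interval (lookup P j) (lookup W j)

  projectionFrom⁺ : ∀ j h s {w} → w ∈ map (project j) (cellsFrom h s) → w ∈ projectionFrom j h s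
  projectionFrom⁺ j h ((P , W) ∷ s) w∈ with ∈-map⁻ (project j) w∈
  ... | x , x∈ , refl with cellsFrom⁻ h (P , W) s x∈
  ... | inj₂ x∈above = ∈-++⁺ʳ (map (h ,_) (interval (lookup P j) (lookup W j)))
                              (projectionFrom⁺ j (suc h) s (∈-map⁺ (project j) x∈above))
  ... | inj₁ (y , refl , y∈) with inBox-lookup P W y j y∈
  ... | lo , hi = ∈-++⁺ˡ (∈-map⁺ (h ,_) (interval⁺ _ _ lo hi))

  projectionFrom⁻ : ∀ j h s {w} → w ∈ projectionFrom j h s → w ∈ map (project j) (cellsFrom h s)
  projectionFrom⁻ j h ((P , W) ∷ s) w∈ with ∈-++⁻ (map (h ,_) (interval (lookup P j) (lookup W j))) w∈
  ... | inj₂ w∈above with ∈-map⁻ (project j) (projectionFrom⁻ j (suc h) s w∈above)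
  ... | x , x∈ , refl = ∈-map⁺ (project j) (cellsFrom-above⁺ h (P , W) s x∈)
  projectionFrom⁻ j h ((P , W) ∷ s) w∈ | inj₁ w∈here with ∈-map⁻ (h ,_) w∈here
  ... | x , x∈ , refl with interval⁻ _ _ x∈
  ... | lo , hi with inBox-lookup⁻ P W j x lo hi
  ... | y , y∈ , refl = ∈-map⁺ (project j) (cellsFrom-stratum⁺ h (P , W) s y∈)

  translatePair : Vec ℤ (suc m) → Fin m → ℕ × ℕ → ℤ × ℤ
  translatePair r j (a , b) = (+ a ℤ.+ V.head r) , (+ b ℤ.+ lookup (V.tail r) j)

  translatePair-injective : ∀ r j {a b} → translatePair r j a ≡ translatePair r j b → a ≡ b
  translatePair-injective r j {a₁ , a₂} {b₁ , b₂} eq =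
    cong₂ _,_ (+-cancelʳ (V.head r) (cong proj₁ eq)) (+-cancelʳ (lookup (V.tail r) j) (cong proj₂ eq))
    where
    +-cancelʳ : ∀ {a b} r → + a ℤ.+ r ≡ + b ℤ.+ r → a ≡ b
    +-cancelʳ {a} {b} r eq =
      ℤP.+-injective (trans (sym (m+n-n≡m (+ a) r)) (trans (cong (ℤ._- r) eq) (m+n-n≡m (+ b) r)))

  lookup-translate : ∀ {k} (t : Vec ℕ k) (r : Vec ℤ k) j → lookup (translate r t) j ≡ + lookup t j ℤ.+ lookup r j
  lookup-translate (x ∷ t) (z ∷ r) zero    = refl
  lookup-translate (x ∷ t) (z ∷ r) (suc j) = lookup-translate t r j

  project-translate : ∀ r j x →
    (V.head (translate r x) , lookup (V.tail (translate r x)) j) ≡ translatePair r j (project j x)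
  project-translate (z ∷ r) j (h ∷ t) = cong (+ h ℤ.+ z ,_) (lookup-translate t r j)

  projArea-translate : ∀ r s (A : CellSet (suc m)) → (∀ c → c ∈ A ⇔ c ∈ map (translate r) (cellsFrom 0 s)) →
                       ∀ j → projArea A j ≡ projectionSize j s
  projArea-translate r s A A⇔ j = trans
    (length-deduplicate-≡ _ (translatePair r j) (translatePair-injective r j) _
      (projectionFrom j 0 s) (projectionFrom-unique j 0 s) same)
    (length-projectionFrom j 0 s)
    where
    π : Cell (suc m) → ℤ × ℤ
    π c = V.head c , lookup (V.tail c) j
    same : ∀ z → z ∈ map π A ⇔ z ∈ map (translatePair r j) (projectionFrom j 0 s)
    same z = mk⇔ to from
      where
      to : z ∈ map π A → z ∈ map (translatePair r j) (projectionFrom j 0 s)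
      to z∈ with ∈-map⁻ π z∈
      ... | c , c∈ , refl with ∈-map⁻ (translate r) (Equivalence.to (A⇔ c) c∈)
      ... | x , x∈ , refl = subst (_∈ map (translatePair r j) (projectionFrom j 0 s)) (sym (project-translate r j x))
                              (∈-map⁺ (translatePair r j) (projectionFrom⁺ j 0 s (∈-map⁺ (project j) x∈)))
      from : z ∈ map (translatePair r j) (projectionFrom j 0 s) → z ∈ map π A
      from z∈ with ∈-map⁻ (translatePair r j) z∈
      ... | w , w∈ , refl with ∈-map⁻ (project j) (projectionFrom⁻ j 0 s w∈)
      ... | x , x∈ , refl = subst (_∈ map π A) (project-translate r j x)
                              (∈-map⁺ π (Equivalence.from (A⇔ (translate r x)) (∈-map⁺ (translate r) x∈)))

  sum-sides : ∀ {k} (W : Vec ℕ k) → sum (map (λ j → suc (lookup W j)) (L.allFin k)) ≡ sideSum W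
  sum-sides W = trans (cong sum (LP.map-tabulate id (λ j → suc (lookup W j)))) (tabulated W)
    where
    tabulated : ∀ {k} (W : Vec ℕ k) → sum (L.tabulate (λ j → suc (lookup W j))) ≡ sideSum W
    tabulated []      = refl
    tabulated (w ∷ W) = cong (suc w ℕ.+_) (tabulated W)

  sum-projectionSize : ∀ s → sum (map (λ j → projectionSize j s) (L.allFin m)) ≡ shapeArea s
  sum-projectionSize []            = trans (sum-map-const 0 (L.allFin m)) (ℕP.*-zeroʳ (length (L.allFin m)))
  sum-projectionSize ((P , W) ∷ s) =
    trans (sum-map-+ (λ j → suc (lookup W j)) (λ j → projectionSize j s) (L.allFin m))
          (cong₂ ℕ._+_ (sum-sides W) (sum-projectionSize s))

  lateralArea-translate : ∀ r s (A : CellSet (suc m)) → (∀ c → c ∈ A ⇔ c ∈ map (translate r) (cellsFrom 0 s)) →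
                          lateralArea A ≡ shapeArea s
  lateralArea-translate r s A A⇔ =
    trans (cong sum (LP.map-cong (projArea-translate r s A A⇔) (L.allFin m))) (sum-projectionSize s)

  lateralArea-cells : ∀ s → lateralArea (cells s) ≡ shapeArea s
  lateralArea-cells s = lateralArea-translate (toℤ zeros) s (cells s) λ c → mk⇔
    (subst (c ∈_) (sym cells≡))
    (subst (c ∈_) cells≡)
    where
    cells≡ : map (translate (toℤ zeros)) (cellsFrom 0 s) ≡ cells s
    cells≡ = LP.map-cong (λ x → +ᵛ-identityʳ (toℤ x)) (cellsFrom 0 s)

  -- The chains from P of area n with at most fuel strata.
  chains : Vec ℕ m → ℕ → ℕ → List Shape
  chains P zero       n = []
  chains P (suc fuel) n = map (λ W → [ (P , W) ]) (widthVectors m n) ++ concatMap higher (upTo (suc n))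
    where
    higher : ℕ → List Shape
    higher i = concatMap (λ W → concatMap (λ Q → map ((P , W) ∷_) (chains Q fuel (n ∸ i))) (boxPoints P W))
                         (widthVectors m i)

  chains-sound : ∀ P fuel n {s} → s ∈ chains P fuel n → Chain P s × shapeArea s ≡ n
  chains-sound P (suc fuel) n s∈ with ∈-++⁻ (map (λ W → [ (P , W) ]) (widthVectors m n)) s∈
  ... | inj₁ s∈one with ∈-map⁻ (λ W → [ (P , W) ]) s∈one
  ... | W , W∈ , refl = one , trans (ℕP.+-identityʳ _) (widthVectors⁻ m n W∈)
  chains-sound P (suc fuel) n s∈ | inj₂ s∈more with ∈-concatMap⁻′ _ (upTo (suc n)) s∈more
  ... | i , i∈ , s∈₁ with ∈-concatMap⁻′ _ (widthVectors m i) s∈₁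
  ... | W , W∈ , s∈₂ with ∈-concatMap⁻′ _ (boxPoints P W) s∈₂
  ... | Q , Q∈ , s∈₃ with ∈-map⁻ ((P , W) ∷_) s∈₃
  ... | s′ , s′∈ , refl with chains-sound Q fuel (n ∸ i) s′∈
  ... | chain , area =
    more (boxPoints⁻ P W Q∈) chain ,
    trans (cong₂ ℕ._+_ (widthVectors⁻ m i W∈) area) (ℕP.m+[n∸m]≡n (ℕP.≤-pred (∈-upTo⁻ i∈)))

  chains-complete : ∀ P fuel n {s} → Chain P s → shapeArea s ≡ n → length s ≤ fuel → s ∈ chains P fuel n
  chains-complete P (suc fuel) n (one {W = W}) area _ = ∈-++⁺ˡ
    (∈-map⁺ (λ W → [ (P , W) ]) (subst (λ n → W ∈ widthVectors m n) (trans (sym (ℕP.+-identityʳ _)) area) (widthVectors⁺ m)))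
  chains-complete P (suc fuel) .(sideSum W ℕ.+ shapeArea s) (more {W = W} {Q} {s} Q∈ chain) refl (s≤s length≤) =
    ∈-++⁺ʳ (map (λ W → [ (P , W) ]) (widthVectors m _))
      (∈-concatMap⁺′ _ (∈-upTo⁺ (s≤s (ℕP.m≤m+n (sideSum W) (shapeArea s))))
        (∈-concatMap⁺′ _ (widthVectors⁺ m)
          (∈-concatMap⁺′ _ (boxPoints⁺ P W Q∈)
            (∈-map⁺ ((P , W) ∷_)
              (chains-complete Q fuel _ chain (sym (ℕP.m+n∸m≡n (sideSum W) (shapeArea s))) length≤)))))

  Chain-∷ : ∀ {P s} → Chain P s → Σ (Vec ℕ m) λ W → Σ Shape λ s′ → s ≡ (P , W) ∷ s′
  Chain-∷ (one {W = W})              = W , [] , refl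
  Chain-∷ (more {W = W} {s = s} _ _) = W , s , refl

  firstSideSum : Shape → ℕ
  firstSideSum []            = 0
  firstSideSum ((_ , W) ∷ _) = sideSum W

  firstWidths : Shape → Vec ℕ m
  firstWidths []            = zeros
  firstWidths ((_ , W) ∷ _) = W

  secondCorner : Shape → Vec ℕ m
  secondCorner (_ ∷ (Q , _) ∷ _) = Q
  secondCorner _                 = zeros

  chains-unique : ∀ P fuel n → Unique (chains P fuel n)
  chains-unique P zero       n = []
  chains-unique P (suc fuel) n = UniqueP.++⁺
    (UniqueP.map⁺ singleton-injective (widthVectors-unique m n))
    (concatMap-unique _ firstSideSum (UniqueP.upTo⁺ (suc n))
      (λ i → concatMap-unique _ firstWidths (widthVectors-unique m i)
        (λ W → concatMap-unique _ secondCorner (boxPoints-unique P W)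
          (λ Q → UniqueP.map⁺ ∷-injectiveʳ′ (chains-unique Q fuel (n ∸ i)))
          (λ Q _ s∈ → secondCorner≡ Q W i s∈))
        (λ W _ s∈ → firstWidths≡ W i s∈))
      (λ i _ s∈ → firstSideSum≡ i s∈))
    disjoint
    where
    singleton-injective : ∀ {W W′} → (Shape ∋ [ (P , W) ]) ≡ [ (P , W′) ] → W ≡ W′
    singleton-injective refl = refl
    ∷-injectiveʳ′ : ∀ {b : Box} {s s′ : Shape} → (Shape ∋ b ∷ s) ≡ b ∷ s′ → s ≡ s′
    ∷-injectiveʳ′ refl = refl
    secondCorner≡ : ∀ Q W i {s} → s ∈ map ((P , W) ∷_) (chains Q fuel (n ∸ i)) → secondCorner s ≡ Q
    secondCorner≡ Q W i s∈ with ∈-map⁻ ((P , W) ∷_) s∈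
    ... | s′ , s′∈ , refl with Chain-∷ (proj₁ (chains-sound Q fuel (n ∸ i) s′∈))
    ... | _ , _ , refl = refl
    firstWidths≡ : ∀ W i {s} → s ∈ concatMap (λ Q → map ((P , W) ∷_) (chains Q fuel (n ∸ i))) (boxPoints P W) →
                   firstWidths s ≡ W
    firstWidths≡ W i s∈ with ∈-concatMap⁻′ _ (boxPoints P W) s∈
    ... | Q , _ , s∈′ with ∈-map⁻ ((P , W) ∷_) s∈′
    ... | _ , _ , refl = refl
    firstSideSum≡ : ∀ i {s} → s ∈ concatMap (λ W → concatMap (λ Q → map ((P , W) ∷_) (chains Q fuel (n ∸ i)))
                                                  (boxPoints P W)) (widthVectors m i) →
                    firstSideSum s ≡ i
    firstSideSum≡ i s∈ with ∈-concatMap⁻′ _ (widthVectors m i) s∈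
    ... | W , W∈ , s∈′ with ∈-concatMap⁻′ _ (boxPoints P W) s∈′
    ... | Q , _ , s∈″ with ∈-map⁻ ((P , W) ∷_) s∈″
    ... | _ , _ , refl = widthVectors⁻ m i W∈
    disjoint : ∀ {s} → ¬ (s ∈ map (λ W → [ (P , W) ]) (widthVectors m n) × s ∈ concatMap _ (upTo (suc n)))
    disjoint (s∈one , s∈more) with ∈-map⁻ (λ W → [ (P , W) ]) s∈one
    ... | W , _ , refl with ∈-concatMap⁻′ _ (upTo (suc n)) s∈more
    ... | i , _ , s∈₁ with ∈-concatMap⁻′ _ (widthVectors m i) s∈₁
    ... | W′ , _ , s∈₂ with ∈-concatMap⁻′ _ (boxPoints P W′) s∈₂
    ... | Q , _ , s∈₃ with ∈-map⁻ ((P , W′) ∷_) s∈₃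
    ... | s′ , s′∈ , eq with Chain-∷ (proj₁ (chains-sound Q fuel (n ∸ i) s′∈))
    ... | _ , _ , refl with eq
    ... | ()

  chainCount : ℕ → ℕ → ℕ
  chainCount zero       n = 0
  chainCount (suc fuel) n =
    boxCount m n ℕ.+ sum (map (λ i → pointedBoxCount m i ℕ.* chainCount fuel (n ∸ i)) (upTo (suc n)))

  length-chains : ∀ P fuel n → length (chains P fuel n) ≡ chainCount fuel n
  length-chains P zero       n = refl
  length-chains P (suc fuel) n = trans (LP.length-++ (map (λ W → [ (P , W) ]) (widthVectors m n)))
    (cong₂ ℕ._+_ (LP.length-map _ (widthVectors m n))
      (trans (length-concatMap (λ i → concatMap (higher i) (widthVectors m i)) (upTo (suc n))) (cong sum (LP.map-cong length-higher (upTo (suc n))))))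
    where
    count : ℕ → ℕ
    count i = chainCount fuel (n ∸ i)
    higher : ℕ → Vec ℕ m → List Shape
    higher i W = concatMap (λ Q → map ((P , W) ∷_) (chains Q fuel (n ∸ i))) (boxPoints P W)
    length-higher-W : ∀ i W → length (higher i W) ≡ count i ℕ.* volume W
    length-higher-W i W = begin
      length (higher i W)
        ≡⟨ length-concatMap _ (boxPoints P W) ⟩
      sum (map (λ Q → length (map ((P , W) ∷_) (chains Q fuel (n ∸ i)))) (boxPoints P W))
        ≡⟨ cong sum (LP.map-cong (λ Q → trans (LP.length-map _ (chains Q fuel (n ∸ i))) (length-chains Q fuel (n ∸ i)))
                                 (boxPoints P W)) ⟩
      sum (map (λ _ → count i) (boxPoints P W))
        ≡⟨ sum-map-const _ (boxPoints P W) ⟩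
      length (boxPoints P W) ℕ.* count i
        ≡⟨ cong (ℕ._* count i) (length-boxPoints P W) ⟩
      volume W ℕ.* count i
        ≡⟨ ℕP.*-comm (volume W) _ ⟩
      count i ℕ.* volume W ∎
      where open ≡-Reasoning
    length-higher : ∀ i → length (concatMap (higher i) (widthVectors m i)) ≡ pointedBoxCount m i ℕ.* count i
    length-higher i = begin
      length (concatMap (higher i) (widthVectors m i))        ≡⟨ length-concatMap (higher i) (widthVectors m i) ⟩
      sum (map (length ∘ higher i) (widthVectors m i))        ≡⟨ cong sum (LP.map-cong (length-higher-W i) (widthVectors m i)) ⟩
      sum (map (λ W → count i ℕ.* volume W) (widthVectors m i)) ≡⟨ sum-map-*ˡ (count i) volume (widthVectors m i) ⟩
      count i ℕ.* pointedBoxCount m i                         ≡⟨ ℕP.*-comm (count i) _ ⟩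
      pointedBoxCount m i ℕ.* count i                         ∎
      where open ≡-Reasoning

  -- A finite set N ⊆ ℕ^(m+1), reachable from the origin by elementary steps
  -- and whose strata are boxes, is the set of cells of a chain.
  module Stratification
    (N : Vec ℕ (suc m) → Set) (Ns : List (Vec ℕ (suc m)))
    (N⇒∈Ns : ∀ {x} → N x → x ∈ Ns) (∈Ns⇒N : ∀ {x} → x ∈ Ns → N x)
    (N-origin : N (0 ∷ zeros))
    (N-reach : ∀ {x} → N x → UpPath N (0 ∷ zeros) x)
    (N-plateau : ∀ {x} → N x → Σ Box λ (P , W) → ∀ y → N (V.head x ∷ y) ⇔ InBox P W y)
    where

    top : Vec ℕ (suc m)
    top = argmax V.head (0 ∷ zeros) Ns

    H : ℕ
    H = V.head top

    N-top : N top
    N-top = argmax-all V.head N-origin (All.tabulate ∈Ns⇒N)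

    head≤H : ∀ {x} → N x → V.head x ≤ H
    head≤H Nx = All.lookup (f[xs]≤f[argmax] (0 ∷ zeros) Ns) (N⇒∈Ns Nx)

    head-stepℕ≤ : ∀ (b : Vec ℕ (suc m)) j → V.head (stepℕ b j) ≤ suc (V.head b)
    head-stepℕ≤ (x ∷ b) zero    = ℕP.≤-refl
    head-stepℕ≤ (x ∷ b) (suc j) = ℕP.n≤1+n x

    UpPath-meets-height : ∀ {a b} → UpPath N a b → ∀ h → V.head a ≤ h → h ≤ V.head b →
                          Σ (Vec ℕ (suc m)) λ x → N x × V.head x ≡ h
    UpPath-meets-height (here Na)            h a≤h h≤a = _ , Na , ℕP.≤-antisym a≤h h≤a
    UpPath-meets-height (fwd {b = b} j p Nb′) h a≤h h≤b′ with h ℕ.≤? V.head b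
    ... | yes h≤b = UpPath-meets-height p h a≤h h≤b
    ... | no  h≰b = stepℕ b j , Nb′ , ℕP.≤-antisym (ℕP.≤-trans (head-stepℕ≤ b j) (ℕP.≰⇒> h≰b)) h≤b′

    StratumIs : ℕ → Box → Set
    StratumIs h B = ∀ y → N (h ∷ y) ⇔ InBox (proj₁ B) (proj₂ B) y

    stratum : ∀ h → h ≤ H → Σ Box (StratumIs h)
    stratum h h≤H with UpPath-meets-height (N-reach N-top) h z≤n h≤H
    ... | (_ ∷ _) , Nx , refl = N-plateau Nx

    lookup-stepℕ : ∀ {k} (b : Vec ℕ k) j → lookup (stepℕ b j) j ≡ suc (lookup b j)
    lookup-stepℕ (x ∷ b) zero    = refl
    lookup-stepℕ (x ∷ b) (suc j) = lookup-stepℕ b j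

    -- The last step of a path into the corner of stratum h + 1 cannot be a
    -- lateral one, since the corner is minimal in its stratum.
    corner-above∈box : ∀ h B B′ → StratumIs h B → StratumIs (suc h) B′ → InBox (proj₁ B) (proj₂ B) (proj₁ B′)
    corner-above∈box h (P , W) (P′ , W′) stratum-h stratum-h+1 = lastStep (N-reach N-corner) refl
      where
      N-corner : N (suc h ∷ P′)
      N-corner = Equivalence.from (stratum-h+1 P′) (inBox-corner P′ W′)
      lastStep : ∀ {t} → UpPath N (0 ∷ zeros) t → t ≡ suc h ∷ P′ → InBox P W P′
      lastStep (here _) ()
      lastStep (fwd {b = _ ∷ y} zero    p _) refl = Equivalence.to (stratum-h y) (UpPath-end p)
      lastStep (fwd {b = _ ∷ y} (suc j) p _) eq with cong V.head eq | cong V.tail eq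
      ... | refl | refl with inBox-lookup P′ W′ y j (Equivalence.to (stratum-h+1 y) (UpPath-end p))
      ... | P′≤y , _ = ⊥-elim (ℕP.<-irrefl refl (subst (ℕ._≤ lookup y j) (lookup-stepℕ y j) P′≤y))

    boxAt : ∀ h → h ≤ H → Box
    boxAt h h≤H = proj₁ (stratum h h≤H)

    boxAt-stratum : ∀ h h≤H → StratumIs h (boxAt h h≤H)
    boxAt-stratum h h≤H = proj₂ (stratum h h≤H)

    h+k≡H⇒h≤H : ∀ h k → h ℕ.+ k ≡ H → h ≤ H
    h+k≡H⇒h≤H h k eq = ℕP.m+n≤o⇒m≤o h (ℕP.≤-reflexive eq)

    h+1+k≡H : ∀ h k → h ℕ.+ suc k ≡ H → suc h ℕ.+ k ≡ H
    h+1+k≡H h k eq = trans (sym (ℕP.+-suc h k)) eq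

    shapeFrom : ∀ h k → h ℕ.+ k ≡ H → Shape
    shapeFrom h zero    eq = boxAt h (h+k≡H⇒h≤H h 0 eq) ∷ []
    shapeFrom h (suc k) eq = boxAt h (h+k≡H⇒h≤H h (suc k) eq) ∷ shapeFrom (suc h) k (h+1+k≡H h k eq)

    shapeFrom-chain : ∀ h k eq → Chain (proj₁ (boxAt h (h+k≡H⇒h≤H h k eq))) (shapeFrom h k eq)
    shapeFrom-chain h zero    eq = one
    shapeFrom-chain h (suc k) eq = more
      (corner-above∈box h _ _ (boxAt-stratum h _) (boxAt-stratum (suc h) _))
      (shapeFrom-chain (suc h) k (h+1+k≡H h k eq))

    shapeFrom⁻ : ∀ h k eq {x} → x ∈ cellsFrom h (shapeFrom h k eq) → N x
    shapeFrom⁻ h zero    eq x∈ with cellsFrom⁻ h (boxAt h (h+k≡H⇒h≤H h 0 eq)) [] x∈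
    ... | inj₁ (y , refl , y∈) = Equivalence.from (boxAt-stratum h _ y) y∈
    shapeFrom⁻ h (suc k) eq x∈ with cellsFrom⁻ h (boxAt h (h+k≡H⇒h≤H h (suc k) eq)) (shapeFrom (suc h) k (h+1+k≡H h k eq)) x∈
    ... | inj₁ (y , refl , y∈) = Equivalence.from (boxAt-stratum h _ y) y∈
    ... | inj₂ x∈above         = shapeFrom⁻ (suc h) k (h+1+k≡H h k eq) x∈above

    shapeFrom⁺ : ∀ h k eq {x} → N x → h ≤ V.head x → x ∈ cellsFrom h (shapeFrom h k eq)
    shapeFrom⁺ h zero    eq {x ∷ y} Nx h≤x
      with ℕP.≤-antisym h≤x (subst (x ≤_) (sym (trans (sym (ℕP.+-identityʳ h)) eq)) (head≤H Nx))
    ... | refl = cellsFrom-stratum⁺ h (boxAt h _) [] (Equivalence.to (boxAt-stratum h _ y) Nx)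
    shapeFrom⁺ h (suc k) eq {x ∷ y} Nx h≤x with ℕP.m≤n⇒m<n∨m≡n h≤x
    ... | inj₂ refl = cellsFrom-stratum⁺ h (boxAt h _) (shapeFrom (suc h) k (h+1+k≡H h k eq))
                        (Equivalence.to (boxAt-stratum h _ y) Nx)
    ... | inj₁ h<x  = cellsFrom-above⁺ h (boxAt h _) (shapeFrom (suc h) k (h+1+k≡H h k eq))
                        (shapeFrom⁺ (suc h) k (h+1+k≡H h k eq) Nx h<x)

    inBox-zeros⇒corner≡zeros : ∀ {k} (P W : Vec ℕ k) → InBox P W zeros → P ≡ zeros
    inBox-zeros⇒corner≡zeros []      []      tt                 = refl
    inBox-zeros⇒corner≡zeros (p ∷ P) (w ∷ W) ((z≤n , _) , rest) = cong (0 ∷_) (inBox-zeros⇒corner≡zeros P W rest)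

    shape : Shape
    shape = shapeFrom 0 H refl

    shape-chain : Chain zeros shape
    shape-chain = subst (λ P → Chain P shape)
      (inBox-zeros⇒corner≡zeros _ _ (Equivalence.to (boxAt-stratum 0 _ zeros) N-origin))
      (shapeFrom-chain 0 H refl)

    shape-cells : ∀ x → N x ⇔ x ∈ cellsFrom 0 shape
    shape-cells x = mk⇔ (λ Nx → shapeFrom⁺ 0 H refl Nx z≤n) (shapeFrom⁻ 0 H refl)

  -- Translating a directed plateau polyhypercube so that its root is the
  -- origin puts it in ℕ^(m+1), where it is stratified.
  module NormalForm (A : CellSet (suc m)) (dpp : IsDirectedPlateau A) where

    r : Cell (suc m)
    r = proj₁ (proj₁ (proj₂ dpp))

    r∈A : r ∈ A
    r∈A = proj₁ (proj₂ (proj₁ (proj₂ dpp)))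

    reach : ∀ {c} → c ∈ A → DirPath A r c
    reach = proj₂ (proj₂ (proj₁ (proj₂ dpp)))

    N : Vec ℕ (suc m) → Set
    N x = translate r x ∈ A

    N-origin : N (0 ∷ zeros)
    N-origin = subst (_∈ A) (sym (+ᵛ-identityˡ r)) r∈A

    DirPath⇒UpPath : ∀ {c} → DirPath A r c → Σ (Vec ℕ (suc m)) λ x → c ≡ translate r x × UpPath N (0 ∷ zeros) x
    DirPath⇒UpPath (here _) = (0 ∷ zeros) , sym (+ᵛ-identityˡ r) , here N-origin
    DirPath⇒UpPath (fwd j p c∈) with DirPath⇒UpPath p
    ... | x , refl , path = stepℕ x j , translate-step r x j , fwd j path (subst (_∈ A) (translate-step r x j) c∈)

    preimage : ∀ {c} → c ∈ A → Σ (Vec ℕ (suc m)) λ x → c ≡ translate r x × UpPath N (0 ∷ zeros) x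
    preimage c∈ = DirPath⇒UpPath (reach c∈)

    untranslate : Cell (suc m) → Vec ℕ (suc m)
    untranslate c = V.map ℤ.∣_∣ (c +ᵛ (-ᵛ r))

    untranslate-translate : ∀ x → untranslate (translate r x) ≡ x
    untranslate-translate x = trans (cong (V.map ℤ.∣_∣) (+ᵛ-cancelʳ (toℤ x) r)) (∣toℤ∣ x)

    Ns : List (Vec ℕ (suc m))
    Ns = map untranslate A

    N⇒∈Ns : ∀ {x} → N x → x ∈ Ns
    N⇒∈Ns {x} Nx = subst (_∈ Ns) (untranslate-translate x) (∈-map⁺ untranslate Nx)

    ∈Ns⇒N : ∀ {x} → x ∈ Ns → N x
    ∈Ns⇒N x∈ with ∈-map⁻ untranslate x∈
    ... | c , c∈ , refl with preimage c∈
    ... | x , refl , _ = subst N (sym (untranslate-translate x)) c∈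

    N-reach : ∀ {x} → N x → UpPath N (0 ∷ zeros) x
    N-reach Nx with preimage Nx
    ... | x′ , eq , path = subst (UpPath N (0 ∷ zeros)) (sym (translate-injective r eq)) path

    N-plateau : ∀ {x} → N x → Σ Box λ (P , W) → ∀ y → N (V.head x ∷ y) ⇔ InBox P W y
    N-plateau {h ∷ x} Nx with proj₂ (proj₂ dpp) Nx
    ... | lo , hi , stratum = (low , V.zipWith _∸_ high low) , λ y → mk⇔ (to y) (from y)
      where
      rₜ = V.tail r
      atHeight : ∀ y → translate r (h ∷ y) ≡ V.head (translate r (h ∷ x)) ∷ translate rₜ y
      atHeight y = trans (translate-∷ r h y) (cong (_∷ _) (sym (cong V.head (translate-∷ r h x))))
      lo≤hi : Pointwise ℤ._≤_ lo hi
      lo≤hi with Equivalence.to (stratum (translate rₜ x)) (subst (_∈ A) (atHeight x) Nx)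
      ... | lo≤ , ≤hi = PW.trans ℤP.≤-trans lo≤ ≤hi
      lo∈ = Equivalence.from (stratum lo) (PW.refl ℤP.≤-refl , lo≤hi)
      hi∈ = Equivalence.from (stratum hi) (lo≤hi , PW.refl ℤP.≤-refl)
      low  = V.tail (proj₁ (preimage lo∈))
      high = V.tail (proj₁ (preimage hi∈))
      lo≡ : lo ≡ translate rₜ low
      lo≡ = trans (cong V.tail (proj₁ (proj₂ (preimage lo∈)))) (tail-translate r (proj₁ (preimage lo∈)))
      hi≡ : hi ≡ translate rₜ high
      hi≡ = trans (cong V.tail (proj₁ (proj₂ (preimage hi∈)))) (tail-translate r (proj₁ (preimage hi∈)))
      low≤high : Pointwise _≤_ low high
      low≤high = translate-mono⁻ rₜ low high (subst₂ (Pointwise ℤ._≤_) lo≡ hi≡ lo≤hi)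
      to : ∀ y → N (h ∷ y) → InBox low (V.zipWith _∸_ high low) y
      to y Ny with Equivalence.to (stratum (translate rₜ y)) (subst (_∈ A) (atHeight y) Ny)
      ... | lo≤y , y≤hi = Pointwise⇒inBox low high y low≤high
        (translate-mono⁻ rₜ low y (subst (λ l → Pointwise ℤ._≤_ l (translate rₜ y)) lo≡ lo≤y))
        (translate-mono⁻ rₜ y high (subst (Pointwise ℤ._≤_ (translate rₜ y)) hi≡ y≤hi))
      from : ∀ y → InBox low (V.zipWith _∸_ high low) y → N (h ∷ y)
      from y y∈ with inBox⇒Pointwise low high y low≤high y∈
      ... | low≤y , y≤high = subst (_∈ A) (sym (atHeight y)) (Equivalence.from (stratum (translate rₜ y))
        ( subst (λ l → Pointwise ℤ._≤_ l (translate rₜ y)) (sym lo≡) (translate-mono⁺ rₜ low y low≤y)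
        , subst (Pointwise ℤ._≤_ (translate rₜ y)) (sym hi≡) (translate-mono⁺ rₜ y high y≤high)))

    open Stratification N Ns N⇒∈Ns ∈Ns⇒N N-origin N-reach N-plateau public using (shape; shape-chain; shape-cells)

    A⇔translated-shape : ∀ c → c ∈ A ⇔ c ∈ map (translate r) (cellsFrom 0 shape)
    A⇔translated-shape c = mk⇔ to from
      where
      to : c ∈ A → c ∈ map (translate r) (cellsFrom 0 shape)
      to c∈ with preimage c∈
      ... | x , refl , _ = ∈-map⁺ (translate r) (Equivalence.to (shape-cells x) c∈)
      from : c ∈ map (translate r) (cellsFrom 0 shape) → c ∈ A
      from c∈ with ∈-map⁻ (translate r) c∈
      ... | x , x∈ , refl = Equivalence.from (shape-cells x) x∈

    A-translate-shape : Translate A (cells shape)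
    A-translate-shape = -ᵛ r , λ c → mk⇔ (to c) (from c)
      where
      to : ∀ c → c ∈ A → c +ᵛ (-ᵛ r) ∈ cells shape
      to c c∈ with preimage c∈
      ... | x , refl , _ = subst (_∈ cells shape) (sym (+ᵛ-cancelʳ (toℤ x) r))
                             (∈-map⁺ toℤ (Equivalence.to (shape-cells x) c∈))
      from : ∀ c → c +ᵛ (-ᵛ r) ∈ cells shape → c ∈ A
      from c c∈ with ∈-map⁻ toℤ c∈
      ... | y , y∈ , eq = subst (_∈ A) (trans (cong (_+ᵛ r) (sym eq)) (-ᵛ-cancelʳ c r))
                            (Equivalence.from (shape-cells y) y∈)

    lateralArea≡shapeArea : lateralArea A ≡ shapeArea shape
    lateralArea≡shapeArea = lateralArea-translate r shape A A⇔translated-shape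

  cellsFrom-⊆⇒inBox-⊆ : ∀ h B B′ t t′ → (∀ x → x ∈ cellsFrom h (B′ ∷ t′) → x ∈ cellsFrom h (B ∷ t)) →
                        ∀ y → InBox (proj₁ B′) (proj₂ B′) y → InBox (proj₁ B) (proj₂ B) y
  cellsFrom-⊆⇒inBox-⊆ h B B′ t t′ ⊆ y y∈ = cellsFrom-stratum⁻ h B t (⊆ (h ∷ y) (cellsFrom-stratum⁺ h B′ t′ y∈))

  cellsFrom-above-⊆ : ∀ h B t t′ {x} → x ∈ cellsFrom (suc h) t → x ∈ cellsFrom h (B ∷ t′) → x ∈ cellsFrom (suc h) t′
  cellsFrom-above-⊆ h B t t′ x∈ x∈′ =
    cellsFrom-above⁻ h B t′ x∈′ λ eq → ℕP.<-irrefl (sym eq) (cellsFrom-head (suc h) t x∈)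

  cellsFrom-injective : ∀ h s s′ → (∀ x → x ∈ cellsFrom h s ⇔ x ∈ cellsFrom h s′) → s ≡ s′
  cellsFrom-injective h [] [] _ = refl
  cellsFrom-injective h [] ((P , W) ∷ s′) same
    with Equivalence.from (same (h ∷ P)) (cellsFrom-stratum⁺ h (P , W) s′ (inBox-corner P W))
  ... | ()
  cellsFrom-injective h ((P , W) ∷ s) [] same
    with Equivalence.to (same (h ∷ P)) (cellsFrom-stratum⁺ h (P , W) s (inBox-corner P W))
  ... | ()
  cellsFrom-injective h ((P , W) ∷ s) ((P′ , W′) ∷ s′) same
    with inBox-corners⇒≡ P W P′ W′
           (cellsFrom-⊆⇒inBox-⊆ h (P , W) (P′ , W′) s s′ (Equivalence.from ∘ same) P′ (inBox-corner P′ W′))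
           (cellsFrom-⊆⇒inBox-⊆ h (P′ , W′) (P , W) s′ s (Equivalence.to ∘ same) P (inBox-corner P W))
           (cellsFrom-⊆⇒inBox-⊆ h (P , W) (P′ , W′) s s′ (Equivalence.from ∘ same) _ (inBox-farCorner P′ W′))
           (cellsFrom-⊆⇒inBox-⊆ h (P′ , W′) (P , W) s′ s (Equivalence.to ∘ same) _ (inBox-farCorner P W))
  ... | refl , refl = cong ((P , W) ∷_) (cellsFrom-injective (suc h) s s′ λ x → mk⇔
    (λ x∈ → cellsFrom-above-⊆ h (P , W) s s′ x∈ (Equivalence.to (same x) (cellsFrom-above⁺ h (P , W) s x∈)))
    (λ x∈ → cellsFrom-above-⊆ h (P , W) s′ s x∈ (Equivalence.from (same x) (cellsFrom-above⁺ h (P , W) s′ x∈))))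

  ∈-map-toℤ⁻ : ∀ {k} (X : List (Vec ℕ k)) x → toℤ x ∈ map toℤ X → x ∈ X
  ∈-map-toℤ⁻ X x x∈ with ∈-map⁻ toℤ x∈
  ... | y , y∈ , eq = subst (_∈ X) (sym (toℤ-injective eq)) y∈

  -- Both shapes contain the origin, so a translation vector v between them
  -- and its opposite both have natural coordinates: v = 0.
  translate-chains⇒≡ : ∀ {s s′} → Chain zeros s → Chain zeros s′ → Translate (cells s) (cells s′) → s ≡ s′
  translate-chains⇒≡ {s} {s′} c c′ (v , s⇔s′) = cellsFrom-injective 0 s s′ λ x → mk⇔
    (λ x∈ → ∈-map-toℤ⁻ (cellsFrom 0 s′) x (subst (_∈ cells s′) (trans (cong (toℤ x +ᵛ_) v≡0) (+ᵛ-identityʳ (toℤ x)))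
                                           (Equivalence.to (s⇔s′ (toℤ x)) (∈-map⁺ toℤ x∈))))
    (λ x∈ → ∈-map-toℤ⁻ (cellsFrom 0 s) x (Equivalence.from (s⇔s′ (toℤ x))
              (subst (_∈ cells s′) (sym (trans (cong (toℤ x +ᵛ_) v≡0) (+ᵛ-identityʳ (toℤ x)))) (∈-map⁺ toℤ x∈))))
    where
    origin∈ : ∀ {t} → Chain zeros t → toℤ (0 ∷ zeros) ∈ cells t
    origin∈ ct = ∈-map⁺ toℤ (Chain-corner∈ ct 0)
    v∈ : v ∈ cells s′
    v∈ = subst (_∈ cells s′) (+ᵛ-identityˡ v) (Equivalence.to (s⇔s′ _) (origin∈ c))
    -v∈ : -ᵛ v ∈ cells s
    -v∈ = Equivalence.from (s⇔s′ (-ᵛ v)) (subst (_∈ cells s′) (sym (+ᵛ-inverseˡ v)) (origin∈ c′))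
    v≡0 : v ≡ toℤ zeros
    v≡0 with ∈-map⁻ toℤ v∈ | ∈-map⁻ toℤ -v∈
    ... | y , _ , v≡y | y′ , _ , -v≡y′ = toℤ-and-neg-toℤ⇒zeros v y y′ v≡y -v≡y′

-- Counting

module Counting (k : ℕ) where

  open Shapes (suc k)

  dppCount : ℕ → ℕ
  dppCount n = chainCount (suc n) n

  length≤shapeArea : ∀ s → length s ≤ shapeArea s
  length≤shapeArea []                  = z≤n
  length≤shapeArea ((P , w ∷ W) ∷ s) =
    ℕP.≤-trans (s≤s (length≤shapeArea s)) (ℕP.+-monoˡ-≤ (shapeArea s) (s≤s z≤n))

  dppCount-counts : ∀ n → CountDPP (suc k) n (dppCount n)
  dppCount-counts n = map cells E , length≡ , sound , distinct , complete
    where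
    E = chains zeros (suc n) n
    length≡ : length (map cells E) ≡ dppCount n
    length≡ = trans (LP.length-map cells E) (length-chains zeros (suc n) n)
    sound : All (λ A → IsDirectedPlateau A × lateralArea A ≡ n) (map cells E)
    sound = AllP.map⁺ (All.tabulate λ {s} s∈ → let chain , area = chains-sound zeros (suc n) n s∈ in
      cells-directedPlateau chain , trans (lateralArea-cells s) area)
    distinct : AllPairs (λ A B → ¬ Translate A B) (map cells E)
    distinct = AllPairs-map⁺ cells (λ c c′ s≢s′ A→B → s≢s′ (translate-chains⇒≡ c c′ A→B))
      (All.tabulate λ s∈ → proj₁ (chains-sound zeros (suc n) n s∈)) (chains-unique zeros (suc n) n)
    complete : ∀ A → IsDirectedPlateau A → lateralArea A ≡ n → Σ (CellSet (suc (suc k))) λ B → B ∈ map cells E × Translate A B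
    complete A dpp area = cells shape , ∈-map⁺ cells (chains-complete zeros (suc n) n shape-chain shapeArea≡n length≤) ,
                          A-translate-shape
      where
      open NormalForm A dpp
      shapeArea≡n : shapeArea shape ≡ n
      shapeArea≡n = trans (sym lateralArea≡shapeArea) area
      length≤ : length shape ≤ suc n
      length≤ = ℕP.≤-trans (length≤shapeArea shape) (ℕP.≤-trans (ℕP.≤-reflexive shapeArea≡n) (ℕP.n≤1+n n))

  -- Only shapes with at most n strata have area n, so beyond n the fuel is irrelevant.
  chainCount-stable : ∀ fuel fuel′ n → n < fuel → n < fuel′ → chainCount fuel n ≡ chainCount fuel′ n
  chainCount-stable (suc fuel) (suc fuel′) n (s≤s n≤fuel) (s≤s n≤fuel′) =
    cong (λ x → boxCount (suc k) n ℕ.+ sum x) (LP.map-cong-local (All.tabulate λ i∈ → term _ (∈-upTo⁻ i∈)))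
    where
    term : ∀ i → i < suc n → pointedBoxCount (suc k) i ℕ.* chainCount fuel (n ∸ i)
                             ≡ pointedBoxCount (suc k) i ℕ.* chainCount fuel′ (n ∸ i)
    term zero    _         = refl
    term (suc i) (s≤s i<n) = cong (pointedBoxCount (suc k) (suc i) ℕ.*_)
      (chainCount-stable fuel fuel′ (n ∸ suc i) (ℕP.<-≤-trans n-1-i<n n≤fuel) (ℕP.<-≤-trans n-1-i<n n≤fuel′))
      where
      n-1-i<n : n ∸ suc i < n
      n-1-i<n = ℕP.∸-monoʳ-< (s≤s z≤n) i<n

  dppCount-recurrence : ∀ n → + dppCount n ≡
    + boxCount (suc k) n ℤ.+ ((λ i → + pointedBoxCount (suc k) i) ⊛ (λ i → + dppCount i)) n
  dppCount-recurrence n = cong (λ x → + boxCount (suc k) n ℤ.+ x)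
    (trans (pos-sum-upTo n _) (sumTo-cong n term))
    where
    term : ∀ i → i ≤ n → + (pointedBoxCount (suc k) i ℕ.* chainCount n (n ∸ i))
                        ≡ + pointedBoxCount (suc k) i ℤ.* + dppCount (n ∸ i)
    term zero    _   = refl  -- no box has side sum 0
    term (suc i) i≤n = trans (ℤP.pos-* (pointedBoxCount (suc k) (suc i)) _)
      (cong (λ c → + pointedBoxCount (suc k) (suc i) ℤ.* + c)
            (chainCount-stable n (suc (n ∸ suc i)) (n ∸ suc i) (ℕP.∸-monoʳ-< (s≤s z≤n) i≤n) ℕP.≤-refl))

open Counting
open import Data.Nat using (_*_)

-- The hypothesis d ≥ 3 is stronger than needed: the argument works for d ≥ 2.
theorem4 : (m : ℕ) → 2 ≤ m →
    Σ (ℕ → ℕ) λ a →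
      (a 0 ≡ 0) ×
      (∀ n → 1 ≤ n → CountDPP m n (a n)) ×
      (∀ n → ((λ k → + a k) ⊛ (((oneS ⊝ tS) ^S (2 * m)) ⊝ (tS ^S m))) n
             ≡ ((tS ^S m) ⊛ ((oneS ⊝ tS) ^S m)) n)
theorem4 zero    ()
theorem4 (suc k) _ =
  dppCount k , refl , (λ n _ → dppCount-counts k n) ,
  solve-A≗L⊕M⊛A (suc k) _ _ _ (boxCount-series (suc k)) (pointedBoxCount-series (suc k)) (dppCount-recurrence k)
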